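{- Let $G$ be a finite directed graph which is connected, has no circuit, and has no transitivity edge (no edge $(u,v)$ such that there is also a chain of length at least $2$ from $u$ to $v$). Let $c$ be a chain of $G$, let $V_c$ be the set of vertices of $c$ (including its origin and end), let $G_1,\dots,G_k$ be the connected components of the subgraph of $G$ induced on $V_G\setminus V_c$, and for each $j$ let $\overline{G_j}$ be the subgraph of $G$ induced on $V(G_j)\cup V_c$ (the regions of $G$ with respect to $c$). Then $$N(G)=\prod_{j=1}^kN(\overline{G_j}).$$
   Context: A graph $G$ has a finite vertex set $V_G$ and edge set $E_G\subset V_G\times V_G$; for $e=(u,v)$, $\alpha(e)=u$, $\omega(e)=v$. A chain is a sequence of edges $(e_1,\dots,e_k)$ of $G$ with $\omega(e_i)=\alpha(e_{i+1})$ for $i<k$, all edges and vertices distinct; a circuit is a chain with additionally $\omega(e_k)=\alpha(e_1)$. The subgraph induced on $V'\subset V_G$ has vertex set $V'$ and all edges of $G$ with both endpoints in $V'$. Connectedness refers to the underlying undirected graph. A linear extension of $G$ is a total order on $V_G$ with $\alpha(e)$ before $\omega(e)$ for every edge, written as the word $w=w_1\cdots w_n$ in increasing order; $\mathcal L(G)$ is their set. $\Psi(G)=\sum_{w\in\mathcal L(G)}\prod_{i=1}^{n-1}(x_{w_i}-x_{w_{i+1}})^{ -1}$ and $N(G)=\Psi(G)\prod_{e\in E_G}(x_{\alpha(e)}-x_{\omega(e)})$. -}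

module Defs where

open import Data.Nat using (ℕ; zero; suc; _≤_)
open import Data.Fin using (Fin) renaming (_≟_ to _≟ᶠ_)
open import Data.Bool using (Bool; true; false; _∧_; _∨_; not; if_then_else_)
open import Data.List using (List; []; _∷_; length; map; concatMap; allFin; filterᵇ; foldr)
open import Data.Bool.ListAction using (all; any)
open import Data.List.Relation.Unary.Unique.Propositional using (Unique)
open import Data.Product using (Σ; ∃; _×_; _,_)
open import Data.Sum using (_⊎_)
open import Data.Rational using (ℚ; 0ℚ; 1ℚ; _+_; _*_; _-_; 1/_; ≢-nonZero)
open import Data.Rational.Properties using () renaming (_≟_ to _≟ℚ_)
open import Relation.Nullary using (¬_; yes; no; does)
open import Relation.Binary.PropositionalEquality using (_≡_)

Graph : ℕ → Set
Graph n = Fin n → Fin n → Bool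

VSet : ℕ → Set
VSet n = Fin n → Bool

module _ {n : ℕ} (G : Graph n) where

  Edge : Fin n → Fin n → Set
  Edge u v = G u v ≡ true

  data Consec : List (Fin n) → Set where
    c-nil  : Consec []
    c-one  : ∀ v → Consec (v ∷ [])
    c-cons : ∀ u v vs → Edge u v → Consec (v ∷ vs) → Consec (u ∷ v ∷ vs)

  -- A chain is a sequence of edges (e_1,…,e_k), k ≥ 1, with ω(e_i)=α(e_{i+1})
  -- and all edges/vertices distinct.  Since E ⊆ V×V, it is determined by its
  -- vertex sequence α(e_1), ω(e_1), …, ω(e_k) (k+1 distinct vertices).
  IsChain : List (Fin n) → Set
  IsChain vs = 2 ≤ length vs × Unique vs × Consec vs

  LongChainFrom : Fin n → Fin n → Set
  LongChainFrom u v = Σ (List (Fin n)) λ mid →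
    1 ≤ length mid × IsChain (u ∷ mid Data.List.++ (v ∷ []))

  -- a circuit: a chain whose end is its origin; encoded by the k ≥ 1
  -- distinct vertices v_0,…,v_{k-1} with edges v_i → v_{i+1} and v_{k-1} → v_0
  data Last : List (Fin n) → Fin n → Set where
    l-one  : ∀ v → Last (v ∷ []) v
    l-cons : ∀ u vs w → Last vs w → Last (u ∷ vs) w

  HasCircuit : Set
  HasCircuit = Σ (Fin n) λ v₀ → Σ (List (Fin n)) λ rest → Σ (Fin n) λ vₗ →
    Unique (v₀ ∷ rest) × Consec (v₀ ∷ rest) × Last (v₀ ∷ rest) vₗ × Edge vₗ v₀

  TransitivityEdge : Fin n → Fin n → Set
  TransitivityEdge u v = Edge u v × LongChainFrom u v

  data Walk (S : VSet n) : Fin n → Fin n → Set where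
    w-here : ∀ {u} → S u ≡ true → Walk S u u
    w-fwd  : ∀ {u v w} → S u ≡ true → Edge u v → Walk S v w → Walk S u w
    w-bwd  : ∀ {u v w} → S u ≡ true → Edge v u → Walk S v w → Walk S u w

  Connected : Set
  Connected = ∀ u v → Walk (λ _ → true) u v

  IsComponent : VSet n → VSet n → Set
  IsComponent T C =
    (∀ v → C v ≡ true → T v ≡ true) ×
    (Σ (Fin n) λ v → C v ≡ true) ×
    (∀ u v → C u ≡ true → C v ≡ true → Walk C u v) ×
    (∀ u v → C u ≡ true → T v ≡ true → (Edge u v ⊎ Edge v u) → C v ≡ true)

_∈ˡ_ : ∀ {n} → Fin n → List (Fin n) → Bool
v ∈ˡ vs = any (λ u → does (u ≟ᶠ v)) vs

listSet : ∀ {n} → List (Fin n) → VSet n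
listSet vs v = v ∈ˡ vs

_∪_ : ∀ {n} → VSet n → VSet n → VSet n
(A ∪ B) v = A v ∨ B v

complement : ∀ {n} → VSet n → VSet n
complement A v = not (A v)

words : ∀ {n} → ℕ → List (List (Fin n))
words {n} zero    = [] ∷ []
words {n} (suc m) = concatMap (λ w → map (_∷ w) (allFin n)) (words m)

elems : ∀ {n} → VSet n → List (Fin n)
elems {n} S = filterᵇ S (allFin n)

nodupᵇ : ∀ {n} → List (Fin n) → Bool
nodupᵇ []       = true
nodupᵇ (v ∷ vs) = not (v ∈ˡ vs) ∧ nodupᵇ vs

beforeᵇ : ∀ {n} → Fin n → Fin n → List (Fin n) → Bool
beforeᵇ u v []       = false
beforeᵇ u v (w ∷ ws) =
  if does (w ≟ᶠ u) then v ∈ˡ ws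
  else if does (w ≟ᶠ v) then false
  else beforeᵇ u v ws

module _ {n : ℕ} (G : Graph n) (S : VSet n) where

  edgesIn : List (Fin n × Fin n)
  edgesIn = filterᵇ (λ { (u , v) → S u ∧ S v ∧ G u v })
              (concatMap (λ u → map (u ,_) (allFin n)) (allFin n))

  isLinExtᵇ : List (Fin n) → Bool
  isLinExtᵇ w = all S w ∧ nodupᵇ w ∧
                all (λ { (u , v) → beforeᵇ u v w }) edgesIn

  linExts : List (List (Fin n))
  linExts = filterᵇ isLinExtᵇ (words (length (elems S)))

inv : ℚ → ℚ
inv p with p ≟ℚ 0ℚ
... | yes _  = 0ℚ
... | no p≢0 = 1/_ p {{≢-nonZero p≢0}}

prodℚ : List ℚ → ℚ
prodℚ = foldr _*_ 1ℚ

sumℚ : List ℚ → ℚ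
sumℚ = foldr _+_ 0ℚ

module _ {n : ℕ} (x : Fin n → ℚ) where

  termΨ : List (Fin n) → ℚ
  termΨ []           = 1ℚ
  termΨ (a ∷ [])     = 1ℚ
  termΨ (a ∷ b ∷ ws) = inv (x a - x b) * termΨ (b ∷ ws)

Ψ : ∀ {n} → Graph n → VSet n → (Fin n → ℚ) → ℚ
Ψ G S x = sumℚ (map (termΨ x) (linExts G S))

N : ∀ {n} → Graph n → VSet n → (Fin n → ℚ) → ℚ
N G S x = Ψ G S x * prodℚ (map (λ { (u , v) → x u - x v }) (edgesIn G S))

allV : ∀ {n} → VSet n
allV _ = true

-- Write ψ(w) = ∏ 1 / (x_{w_i} − x_{w_{i+1}}) and Δ(w) = ∏ (x_{w_i} − x_{w_{i+1}}) for a word w,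
-- and C for the vertex set of the chain c. As G has no circuit and no transitivity edge, the
-- only edges inside C are those of c; so c is the only linear extension of C and
-- N(C) = ψ(c) Δ(c) = 1. Let A, B be disjoint sets of vertices outside C with no edge between
-- them. Every linear extension of A ∪ B ∪ C is obtained, in exactly one way, by merging a
-- linear extension p of A ∪ C with one q of B ∪ C, and both list C in the order of c. Summing
-- ψ over these merges gives ψ(p) ψ(q) Δ(c): in the induction on p and q the two ways of
-- choosing the next letter outside C recombine by Lagrange interpolation of an affine function
-- at two nodes. Hence Ψ(A ∪ B ∪ C) = Ψ(A ∪ C) Ψ(B ∪ C) Δ(c), and since the edges of A ∪ B ∪ C
-- and of C are, together, those of A ∪ C and of B ∪ C, N(A ∪ B ∪ C) = N(A ∪ C) N(B ∪ C).
-- Induction on the number of components concludes.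

module Submission where

open import Defs
open import Data.Nat using (ℕ; zero; suc; _≤_; z≤n; s≤s)
import Data.Nat.Properties as ℕ
open import Data.Bool using (Bool; true; false; T; _∧_; _∨_; not; if_then_else_)
open import Data.Bool.Properties using (T-≡; ∨-zeroʳ; not-¬; ¬-not; not-injective)
open import Data.Bool.ListAction using (all)
open import Data.Fin using (Fin; zero; suc) renaming (_≟_ to _≟ᶠ_)
open import Data.Fin.Properties using (suc-injective)
open import Data.List using (List; []; _∷_; _++_; length; map; concatMap; filterᵇ; allFin; drop)
open import Data.List.Properties using (++-assoc; map-tabulate; map-∘; ∷-injectiveˡ; ∷-injectiveʳ)
open import Data.List.Membership.Propositional using (_∈_; _∉_; find; lose)
open import Data.List.Membership.Propositional.Properties
  using (∈-∃++; ∈-++⁺ˡ; ∈-++⁺ʳ; ∈-++⁻; ∈-map⁺; ∈-map⁻; ∈-allFin; ∈-filter⁺; ∈-filter⁻; ∈-concatMap⁺; ∈-concatMap⁻)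
open import Data.List.Membership.Propositional.Properties.WithK using (unique∧set⇒bag)
open import Data.List.Relation.Unary.Any using (here; there)
open import Data.List.Relation.Unary.All using ([])
open import Data.List.Relation.Unary.All.Properties.Core using (¬Any⇒All¬)
open import Data.List.Relation.Unary.AllPairs using ([]; _∷_) renaming (tail to Unique-tail)
open import Data.List.Relation.Unary.Unique.Propositional using (Unique)
open import Data.List.Relation.Unary.Unique.Propositional.Properties
  using (Unique[x∷xs]⇒x∉xs; ++⁺; map⁺; allFin⁺)
open import Data.List.Relation.Binary.BagAndSetEquality using (∼bag⇒↭)
open import Data.List.Relation.Binary.Permutation.Propositional using (_↭_)
open import Data.List.Relation.Binary.Permutation.Propositional.Properties using (↭-length)
open import Data.List.Relation.Binary.Permutation.Propositional using (↭⇒↭ₛ)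
open import Data.List.Relation.Binary.Permutation.Setoid.Properties using (foldr-commMonoid)
open import Data.List.Relation.Binary.Permutation.Propositional.Properties using () renaming (map⁺ to ↭-map⁺)
open import Data.Rational using (ℚ; 0ℚ; 1ℚ; _+_; _*_; _-_; -_; ≢-nonZero)
open import Data.Rational.Properties
  using (+-identityˡ; +-identityʳ; *-identityˡ; *-identityʳ; *-assoc; *-comm; *-zeroˡ; *-zeroʳ; *-distribˡ-+; *-distribʳ-+; +-assoc; *-inverseˡ;
         +-0-isCommutativeMonoid; *-1-isCommutativeMonoid)
  renaming (_≟_ to _≟ℚ_)
open import Data.Rational.Solver using (module +-*-Solver)
open +-*-Solver using (solve; _:+_; _:*_; _:-_; :-_; _:=_; con)
open import Data.Product using (Σ; ∃; _×_; _,_; proj₁; proj₂)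
open import Data.Sum using (_⊎_; inj₁; inj₂; [_,_]′) renaming (map to ⊎-map; map₁ to ⊎-map₁; map₂ to ⊎-map₂)
open import Data.Empty using (⊥; ⊥-elim)
open import Relation.Nullary using (¬_; yes; no; does)
open import Relation.Nullary.Decidable using (T?)
open import Relation.Binary.PropositionalEquality
  using (_≡_; _≢_; refl; sym; trans; cong; cong₂; subst; setoid; module ≡-Reasoning)
open import Function using (_∘_; _∘₂_)
open import Function.Bundles using (_⇔_; mk⇔; Equivalence)
open import Function.Definitions using (Injective)

∧≡true⁺ : {a b : Bool} → a ≡ true → b ≡ true → a ∧ b ≡ true
∧≡true⁺ refl refl = refl

∧≡true⁻ : {a b : Bool} → a ∧ b ≡ true → a ≡ true × b ≡ true
∧≡true⁻ {true} b≡true = refl , b≡true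

∨≡true⁻ : {a b : Bool} → a ∨ b ≡ true → a ≡ true ⊎ b ≡ true
∨≡true⁻ {true}  _       = inj₁ refl
∨≡true⁻ {false} b≡true  = inj₂ b≡true

∨≡true⁺ˡ : {a b : Bool} → a ≡ true → a ∨ b ≡ true
∨≡true⁺ˡ refl = refl

∨≡true⁺ʳ : {a b : Bool} → b ≡ true → a ∨ b ≡ true
∨≡true⁺ʳ {true}  _ = refl
∨≡true⁺ʳ {false} b≡true = b≡true

≡true-ext : {a b : Bool} → (a ≡ true → b ≡ true) → (b ≡ true → a ≡ true) → a ≡ b
≡true-ext {true}  a⇒b _   = sym (a⇒b refl)
≡true-ext {false} {true}  _ b⇒a = b⇒a refl
≡true-ext {false} {false} _ _   = refl

module _ {A : Set} where

  ∈-filterᵇ⁻ : (p : A → Bool) {v : A} (xs : List A) → v ∈ filterᵇ p xs → v ∈ xs × p v ≡ true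
  ∈-filterᵇ⁻ p _ m with v∈xs , pv ← ∈-filter⁻ (T? ∘ p) m = v∈xs , Equivalence.to T-≡ pv

  ∈-filterᵇ⁺ : (p : A → Bool) {v : A} {xs : List A} → v ∈ xs → p v ≡ true → v ∈ filterᵇ p xs
  ∈-filterᵇ⁺ p m pv = ∈-filter⁺ (T? ∘ p) m (Equivalence.from T-≡ pv)

  filterᵇ-accept : (p : A → Bool) {v : A} (xs : List A) → p v ≡ true → filterᵇ p (v ∷ xs) ≡ v ∷ filterᵇ p xs
  filterᵇ-accept p xs pv rewrite pv = refl

  filterᵇ-reject : (p : A → Bool) {v : A} (xs : List A) → p v ≡ false → filterᵇ p (v ∷ xs) ≡ filterᵇ p xs
  filterᵇ-reject p xs pv rewrite pv = refl

  filterᵇ-cong : {p q : A → Bool} → (∀ v → p v ≡ q v) → (xs : List A) → filterᵇ p xs ≡ filterᵇ q xs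
  filterᵇ-cong p≗q [] = refl
  filterᵇ-cong {q = q} p≗q (v ∷ xs) rewrite p≗q v with q v
  ... | true  = cong (v ∷_) (filterᵇ-cong p≗q xs)
  ... | false = filterᵇ-cong p≗q xs

  filterᵇ-all : (p : A → Bool) (xs : List A) → (∀ {v} → v ∈ xs → p v ≡ true) → filterᵇ p xs ≡ xs
  filterᵇ-all p []       _    = refl
  filterᵇ-all p (v ∷ xs) all-p =
    trans (filterᵇ-accept p xs (all-p (here refl))) (cong (v ∷_) (filterᵇ-all p xs (all-p ∘ there)))

  filterᵇ-none : (p : A → Bool) (xs : List A) → (∀ {v} → v ∈ xs → p v ≡ false) → filterᵇ p xs ≡ []
  filterᵇ-none p []       _    = refl
  filterᵇ-none p (v ∷ xs) no-p = trans (filterᵇ-reject p xs (no-p (here refl))) (filterᵇ-none p xs (no-p ∘ there))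

  filterᵇ≡[]⇒≡false : (p : A → Bool) (xs : List A) → filterᵇ p xs ≡ [] → ∀ {v} → v ∈ xs → p v ≡ false
  filterᵇ≡[]⇒≡false p xs e {v} v∈xs with p v in pv
  ... | false = refl
  ... | true with () ← subst (v ∈_) e (∈-filterᵇ⁺ p v∈xs pv)

  Unique-∷ : {v : A} {xs : List A} → v ∉ xs → Unique xs → Unique (v ∷ xs)
  Unique-∷ {xs = xs} v∉xs u = ¬Any⇒All¬ xs v∉xs ∷ u

  Unique-filterᵇ : (p : A → Bool) {xs : List A} → Unique xs → Unique (filterᵇ p xs)
  Unique-filterᵇ p [] = []
  Unique-filterᵇ p {v ∷ xs} (v∉xs ∷ u) with p v
  ... | true  = Unique-∷ (Unique[x∷xs]⇒x∉xs (v∉xs ∷ u) ∘ proj₁ ∘ ∈-filterᵇ⁻ p xs) (Unique-filterᵇ p u)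
  ... | false = Unique-filterᵇ p u

  Unique-⇔⇒↭ : {xs ys : List A} → Unique xs → Unique ys → (∀ {v} → v ∈ xs ⇔ v ∈ ys) → xs ↭ ys
  Unique-⇔⇒↭ ux uy xs⇔ys = ∼bag⇒↭ (unique∧set⇒bag ux uy xs⇔ys)

  ∈-delete : ∀ {v a : A} (α β : List A) → v ∈ α ++ a ∷ β → v ≡ a ⊎ v ∈ α ++ β
  ∈-delete []      β (here v≡a)  = inj₁ v≡a
  ∈-delete []      β (there v∈β) = inj₂ v∈β
  ∈-delete (u ∷ α) β (here v≡u)  = inj₂ (here v≡u)
  ∈-delete (u ∷ α) β (there m) with ∈-delete α β m
  ... | inj₁ v≡a = inj₁ v≡a
  ... | inj₂ m′  = inj₂ (there m′)

  ∈-insert : ∀ {v a : A} (α β : List A) → v ∈ α ++ β → v ∈ α ++ a ∷ β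
  ∈-insert []      β m         = there m
  ∈-insert (u ∷ α) β (here e)  = here e
  ∈-insert (u ∷ α) β (there m) = there (∈-insert α β m)

  ∈-[y]⇒≡ : {x y : A} → x ∈ y ∷ [] → x ≡ y
  ∈-[y]⇒≡ (here x≡y) = x≡y

  Unique-delete : ∀ {a : A} (α β : List A) → Unique (α ++ a ∷ β) → Unique (α ++ β)
  Unique-delete []      β (_ ∷ u)       = u
  Unique-delete (u ∷ α) β (u∉ ∷ uniq) =
    Unique-∷ (Unique[x∷xs]⇒x∉xs (u∉ ∷ uniq) ∘ ∈-insert α β) (Unique-delete α β uniq)

  length-delete : ∀ (a : A) (α β : List A) → length (α ++ a ∷ β) ≡ suc (length (α ++ β))
  length-delete a []      β = refl
  length-delete a (u ∷ α) β = cong suc (length-delete a α β)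

  Unique-⊆-length⇒⊇ : {xs ys : List A} → Unique xs → Unique ys → (∀ {v} → v ∈ xs → v ∈ ys) →
    length xs ≡ length ys → ∀ {v} → v ∈ ys → v ∈ xs
  Unique-⊆-length⇒⊇ {[]} {[]} _ _ _ _ ()
  Unique-⊆-length⇒⊇ {a ∷ xs} ux@(_ ∷ uxs) uy xs⊆ys len v∈ys
    with α , β , refl ← ∈-∃++ (xs⊆ys (here refl)) | ∈-delete α β v∈ys
  ... | inj₁ refl = here refl
  ... | inj₂ v∈αβ = there (Unique-⊆-length⇒⊇ uxs (Unique-delete α β uy) xs⊆αβ
                      (ℕ.suc-injective (trans len (length-delete a α β))) v∈αβ)
    where
    xs⊆αβ : ∀ {w} → w ∈ xs → w ∈ α ++ β
    xs⊆αβ {w} w∈xs with ∈-delete α β (xs⊆ys (there w∈xs))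
    ... | inj₁ refl = ⊥-elim (Unique[x∷xs]⇒x∉xs ux w∈xs)
    ... | inj₂ m    = m

module _ {A B : Set} (f : B → List A) where

  ∈-concatMap⁺′ : {L : List B} {w : A} {b : B} → b ∈ L → w ∈ f b → w ∈ concatMap f L
  ∈-concatMap⁺′ b∈L w∈fb = ∈-concatMap⁺ f (lose b∈L w∈fb)

  ∈-concatMap⁻′ : (L : List B) {w : A} → w ∈ concatMap f L → ∃ λ b → b ∈ L × w ∈ f b
  ∈-concatMap⁻′ _ m = find (∈-concatMap⁻ f m)

  Unique-concatMap : {L : List B} → Unique L → (∀ {b} → b ∈ L → Unique (f b)) →
    (∀ {b b′ w} → b ∈ L → b′ ∈ L → w ∈ f b → w ∈ f b′ → b ≡ b′) → Unique (concatMap f L)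
  Unique-concatMap {[]} _ _ _ = []
  Unique-concatMap {b ∷ L} (b∉L ∷ uL) uf same =
    ++⁺ (uf (here refl))
        (Unique-concatMap uL (uf ∘ there) (λ m m′ → same (there m) (there m′)))
        λ (w∈fb , w∈rest) → let b′ , b′∈L , w∈fb′ = ∈-concatMap⁻′ L w∈rest in
          Unique[x∷xs]⇒x∉xs (b∉L ∷ uL) (subst (_∈ L) (sym (same (here refl) (there b′∈L) w∈fb w∈fb′)) b′∈L)

module _ {A : Set} (p : A → Bool) where

  all≡true⁻ : {xs : List A} → all p xs ≡ true → ∀ {v} → v ∈ xs → p v ≡ true
  all≡true⁻ {x ∷ xs} e (here refl) with p x | e
  ... | true | _ = refl
  all≡true⁻ {x ∷ xs} e (there m) with p x | e
  ... | true | e′ = all≡true⁻ e′ m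

  all≡true⁺ : (xs : List A) → (∀ {v} → v ∈ xs → p v ≡ true) → all p xs ≡ true
  all≡true⁺ []       _   = refl
  all≡true⁺ (x ∷ xs) all-p rewrite all-p (here refl) = all≡true⁺ xs (all-p ∘ there)

module _ {n : ℕ} where

  ∈ˡ⇒∈ : {v : Fin n} (vs : List (Fin n)) → (v ∈ˡ vs) ≡ true → v ∈ vs
  ∈ˡ⇒∈ {v} (u ∷ vs) e with u ≟ᶠ v
  ... | yes refl = here refl
  ... | no _     = there (∈ˡ⇒∈ vs e)

  ∈⇒∈ˡ : {v : Fin n} {vs : List (Fin n)} → v ∈ vs → (v ∈ˡ vs) ≡ true
  ∈⇒∈ˡ {v} {u ∷ vs} m with u ≟ᶠ v | m
  ... | yes _  | _          = refl
  ... | no u≢v | here refl  = ⊥-elim (u≢v refl)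
  ... | no _   | there m′   = ∈⇒∈ˡ m′

  ∈ˡ≡false⇒∉ : {v : Fin n} (vs : List (Fin n)) → (v ∈ˡ vs) ≡ false → v ∉ vs
  ∈ˡ≡false⇒∉ vs e m with () ← trans (sym (∈⇒∈ˡ m)) e

  ∉⇒∈ˡ≡false : {v : Fin n} (vs : List (Fin n)) → v ∉ vs → (v ∈ˡ vs) ≡ false
  ∉⇒∈ˡ≡false {v} vs v∉vs with v ∈ˡ vs in e
  ... | true  = ⊥-elim (v∉vs (∈ˡ⇒∈ vs e))
  ... | false = refl

  ∈ˡ-cong : {v : Fin n} {xs ys : List (Fin n)} → (v ∈ xs ⇔ v ∈ ys) → (v ∈ˡ xs) ≡ (v ∈ˡ ys)
  ∈ˡ-cong {v} {xs} {ys} xs⇔ys with v ∈ˡ xs in e₁ | v ∈ˡ ys in e₂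
  ... | true  | true  = refl
  ... | false | false = refl
  ... | true  | false = ⊥-elim (∈ˡ≡false⇒∉ ys e₂ (Equivalence.to xs⇔ys (∈ˡ⇒∈ xs e₁)))
  ... | false | true  = ⊥-elim (∈ˡ≡false⇒∉ xs e₁ (Equivalence.from xs⇔ys (∈ˡ⇒∈ ys e₂)))

  nodupᵇ⇒Unique : (w : List (Fin n)) → nodupᵇ w ≡ true → Unique w
  nodupᵇ⇒Unique []      _ = []
  nodupᵇ⇒Unique (v ∷ w) e with v ∈ˡ w in v∈ˡw
  ... | false = Unique-∷ (∈ˡ≡false⇒∉ w v∈ˡw) (nodupᵇ⇒Unique w e)

  Unique⇒nodupᵇ : {w : List (Fin n)} → Unique w → nodupᵇ w ≡ true
  Unique⇒nodupᵇ []                   = refl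
  Unique⇒nodupᵇ {v ∷ w} u@(_ ∷ uw) rewrite ∉⇒∈ˡ≡false w (Unique[x∷xs]⇒x∉xs u) = Unique⇒nodupᵇ uw

  beforeᵇ-skip : {u v h : Fin n} (w : List (Fin n)) → h ≢ u → h ≢ v → beforeᵇ u v (h ∷ w) ≡ beforeᵇ u v w
  beforeᵇ-skip {u} {v} {h} w h≢u h≢v with h ≟ᶠ u | h ≟ᶠ v
  ... | yes h≡u | _       = ⊥-elim (h≢u h≡u)
  ... | no _    | yes h≡v = ⊥-elim (h≢v h≡v)
  ... | no _    | no _    = refl

  beforeᵇ-head : {u v : Fin n} (w : List (Fin n)) → beforeᵇ u v (u ∷ w) ≡ (v ∈ˡ w)
  beforeᵇ-head {u} w with u ≟ᶠ u
  ... | yes _   = refl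
  ... | no u≢u  = ⊥-elim (u≢u refl)

  beforeᵇ-head-second : {u v : Fin n} (w : List (Fin n)) → v ≢ u → beforeᵇ u v (v ∷ w) ≡ false
  beforeᵇ-head-second {u} {v} w v≢u with v ≟ᶠ u | v ≟ᶠ v
  ... | yes v≡u | _      = ⊥-elim (v≢u v≡u)
  ... | no _    | yes _  = refl
  ... | no _    | no v≢v = ⊥-elim (v≢v refl)

  beforeᵇ-filterᵇ : (T : VSet n) {u v : Fin n} (w : List (Fin n)) → T u ≡ true → T v ≡ true →
    beforeᵇ u v (filterᵇ T w) ≡ beforeᵇ u v w
  beforeᵇ-filterᵇ T [] _ _ = refl
  beforeᵇ-filterᵇ T {u} {v} (h ∷ w) Tu Tv with T h in Th
  ... | true with h ≟ᶠ u
  ...   | yes _ = ∈ˡ-cong {xs = filterᵇ T w} {w} (mk⇔ (proj₁ ∘ ∈-filterᵇ⁻ T w) (λ m → ∈-filterᵇ⁺ T m Tv))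
  ...   | no _ with h ≟ᶠ v
  ...     | yes _ = refl
  ...     | no _  = beforeᵇ-filterᵇ T w Tu Tv
  beforeᵇ-filterᵇ T {u} {v} (h ∷ w) Tu Tv | false =
    trans (beforeᵇ-filterᵇ T w Tu Tv) (sym (beforeᵇ-skip {u} {v} w (outside Tu) (outside Tv)))
    where
    outside : ∀ {y} → T y ≡ true → h ≢ y
    outside Ty refl with () ← trans (sym Th) Ty

  data Adjacent : List (Fin n) → Fin n → Fin n → Set where
    adj-here  : ∀ {a b l} → Adjacent (a ∷ b ∷ l) a b
    adj-there : ∀ {a l u v} → Adjacent l u v → Adjacent (a ∷ l) u v

  Adjacent-∈₁ : ∀ {l u v} → Adjacent l u v → u ∈ l
  Adjacent-∈₁ adj-here      = here refl
  Adjacent-∈₁ (adj-there s) = there (Adjacent-∈₁ s)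

  Adjacent-∈₂ : ∀ {l u v} → Adjacent l u v → v ∈ l
  Adjacent-∈₂ adj-here      = there (here refl)
  Adjacent-∈₂ (adj-there s) = there (Adjacent-∈₂ s)

  Adjacent-≢ : ∀ {l u v} → Unique l → Adjacent l u v → u ≢ v
  Adjacent-≢ ul            adj-here      refl = Unique[x∷xs]⇒x∉xs ul (here refl)
  Adjacent-≢ (_ ∷ ul)      (adj-there s)      = Adjacent-≢ ul s

  Adjacent-beforeᵇ : ∀ {l u v} → Unique l → Adjacent l u v → beforeᵇ u v l ≡ true
  Adjacent-beforeᵇ {a ∷ b ∷ l} _ adj-here = trans (beforeᵇ-head {a} (b ∷ l)) (∈⇒∈ˡ {b} {b ∷ l} (here refl))
  Adjacent-beforeᵇ {a ∷ l} {u} {v} ul@(_ ∷ ul′) (adj-there s) =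
    trans (beforeᵇ-skip {u} {v} {a} l (λ { refl → Unique[x∷xs]⇒x∉xs ul (Adjacent-∈₁ s) })
                          (λ { refl → Unique[x∷xs]⇒x∉xs ul (Adjacent-∈₂ s) }))
          (Adjacent-beforeᵇ ul′ s)

  Adjacent-predecessor : ∀ (a : Fin n) {c h} → h ∈ c → ∃ λ u → Adjacent (a ∷ c) u h
  Adjacent-predecessor a {b ∷ c} (here refl) = a , adj-here
  Adjacent-predecessor a {b ∷ c} (there m)   = let u , s = Adjacent-predecessor b m in u , adj-there s

  adjacent-order⇒≡ : {c w : List (Fin n)} → Unique c → Unique w → (∀ {v} → v ∈ w ⇔ v ∈ c) →
    (∀ {u v} → Adjacent c u v → beforeᵇ u v w ≡ true) → w ≡ c
  adjacent-order⇒≡ {[]} {[]} _ _ _ _ = refl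
  adjacent-order⇒≡ {[]} {h ∷ w} _ _ w⇔c _ with () ← Equivalence.to w⇔c (here refl)
  adjacent-order⇒≡ {a ∷ c} {[]} _ _ w⇔c _ with () ← Equivalence.from w⇔c (here refl)
  adjacent-order⇒≡ {a ∷ c} {h ∷ w} uc@(_ ∷ uc′) uw@(_ ∷ uw′) w⇔c ordered with h ≟ᶠ a
  ... | yes refl =
    cong (h ∷_) (adjacent-order⇒≡ uc′ uw′ (mk⇔ (λ m → skip-h uw m (Equivalence.to w⇔c (there m)))
                                               (λ m → skip-h uc m (Equivalence.from w⇔c (there m))))
      λ {u} {v} s → trans (sym (beforeᵇ-skip {u} {v} {h} w (λ { refl → Unique[x∷xs]⇒x∉xs uc (Adjacent-∈₁ s) })
                                       (λ { refl → Unique[x∷xs]⇒x∉xs uc (Adjacent-∈₂ s) })))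
                  (ordered (adj-there s)))
    where
    skip-h : ∀ {xs ys : List (Fin n)} {v} → Unique (h ∷ xs) → v ∈ xs → v ∈ h ∷ ys → v ∈ ys
    skip-h u v∈xs (here refl) = ⊥-elim (Unique[x∷xs]⇒x∉xs u v∈xs)
    skip-h u v∈xs (there m)   = m
  -- otherwise h has a predecessor in c, which w would have to place before its head h
  ... | no h≢a with Equivalence.to w⇔c (here refl)
  ...   | here h≡a = ⊥-elim (h≢a h≡a)
  ...   | there h∈c with u , s ← Adjacent-predecessor a h∈c
    with () ← trans (sym (ordered s)) (beforeᵇ-head-second {u} {h} w (λ { refl → Adjacent-≢ uc s refl }))

module _ {n : ℕ} where

  ∈words⇒length : (m : ℕ) {w : List (Fin n)} → w ∈ words m → length w ≡ m
  ∈words⇒length zero    (here refl) = refl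
  ∈words⇒length (suc m) w∈
    with w′ , w′∈ , w∈′ ← ∈-concatMap⁻′ (λ w → map (_∷ w) (allFin n)) (words m) w∈
    with a , _ , refl ← ∈-map⁻ (_∷ w′) w∈′ = cong suc (∈words⇒length m w′∈)

  length⇒∈words : (w : List (Fin n)) → w ∈ words (length w)
  length⇒∈words []      = here refl
  length⇒∈words (a ∷ w) =
    ∈-concatMap⁺′ (λ w → map (_∷ w) (allFin n)) (length⇒∈words w) (∈-map⁺ (_∷ w) (∈-allFin a))

  Unique-words : (m : ℕ) → Unique (words {n} m)
  Unique-words zero    = [] ∷ []
  Unique-words (suc m) =
    Unique-concatMap (λ w → map (_∷ w) (allFin n)) (Unique-words m)
      (λ _ → map⁺ (λ { refl → refl }) (allFin⁺ n))
      (λ _ _ m₁ m₂ → trans (sym (tail≡ m₁)) (tail≡ m₂))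
    where
    tail≡ : ∀ {b w} → w ∈ map (_∷ b) (allFin n) → drop 1 w ≡ b
    tail≡ {b} m with _ , _ , refl ← ∈-map⁻ (_∷ b) m = refl

  vertexPairs : List (Fin n × Fin n)
  vertexPairs = concatMap (λ u → map (u ,_) (allFin n)) (allFin n)

  ∈-vertexPairs : (u v : Fin n) → (u , v) ∈ vertexPairs
  ∈-vertexPairs u v = ∈-concatMap⁺′ (λ u → map (u ,_) (allFin n)) (∈-allFin u) (∈-map⁺ (u ,_) (∈-allFin v))

  Unique-vertexPairs : Unique vertexPairs
  Unique-vertexPairs =
    Unique-concatMap (λ u → map (u ,_) (allFin n)) (allFin⁺ n)
      (λ _ → map⁺ (λ { refl → refl }) (allFin⁺ n))
      (λ _ _ m₁ m₂ → trans (sym (proj₁≡ m₁)) (proj₁≡ m₂))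
    where
    proj₁≡ : ∀ {u} {e : Fin n × Fin n} → e ∈ map (u ,_) (allFin n) → proj₁ e ≡ u
    proj₁≡ {u} m with _ , _ , refl ← ∈-map⁻ (u ,_) m = refl

  -- edgesIn G S unfolds to filterᵇ (edgeᵇ G S) vertexPairs
  edgeᵇ : Graph n → VSet n → Fin n × Fin n → Bool
  edgeᵇ G S (u , v) = S u ∧ S v ∧ G u v

  module _ (G : Graph n) (S : VSet n) {u v : Fin n} where

    edgeᵇ≡true⁻ : edgeᵇ G S (u , v) ≡ true → S u ≡ true × S v ≡ true × G u v ≡ true
    edgeᵇ≡true⁻ e with Su , e′ ← ∧≡true⁻ {S u} e with Sv , Guv ← ∧≡true⁻ {S v} e′ = Su , Sv , Guv

    edgeᵇ≡true⁺ : S u ≡ true → S v ≡ true → G u v ≡ true → edgeᵇ G S (u , v) ≡ true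
    edgeᵇ≡true⁺ Su Sv Guv = ∧≡true⁺ Su (∧≡true⁺ Sv Guv)

  module _ (G : Graph n) where

    ∈edgesIn⁻ : (S : VSet n) {u v : Fin n} → (u , v) ∈ edgesIn G S →
      S u ≡ true × S v ≡ true × G u v ≡ true
    ∈edgesIn⁻ S m = edgeᵇ≡true⁻ G S (proj₂ (∈-filterᵇ⁻ (edgeᵇ G S) vertexPairs m))

    ∈edgesIn⁺ : (S : VSet n) {u v : Fin n} → S u ≡ true → S v ≡ true → G u v ≡ true →
      (u , v) ∈ edgesIn G S
    ∈edgesIn⁺ S {u} {v} Su Sv Guv =
      ∈-filterᵇ⁺ (edgeᵇ G S) (∈-vertexPairs u v) (edgeᵇ≡true⁺ G S Su Sv Guv)

    Unique-edgesIn : (S : VSet n) → Unique (edgesIn G S)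
    Unique-edgesIn S = Unique-filterᵇ (edgeᵇ G S) Unique-vertexPairs

    record IsLinExt (S : VSet n) (w : List (Fin n)) : Set where
      field
        unique   : Unique w
        ⊆S       : ∀ {v} → v ∈ w → S v ≡ true
        ⊇S       : ∀ {v} → S v ≡ true → v ∈ w
        respects : ∀ {u v} → S u ≡ true → S v ≡ true → G u v ≡ true → beforeᵇ u v w ≡ true

    module _ (S : VSet n) where

      Unique-elems : Unique (elems S)
      Unique-elems = Unique-filterᵇ S (allFin⁺ n)

      ∈linExts⇒IsLinExt : {w : List (Fin n)} → w ∈ linExts G S → IsLinExt S w
      ∈linExts⇒IsLinExt {w} m with w∈words , isLinExt ← ∈-filterᵇ⁻ (isLinExtᵇ G S) (words (length (elems S))) m
        with all S w in ⊆S | nodupᵇ w in nodup | isLinExt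
      ... | true | true | resp = record
        { unique   = unique
        ; ⊆S       = all≡true⁻ S ⊆S
        ; ⊇S       = λ Sv → Unique-⊆-length⇒⊇ unique Unique-elems
                      (λ v∈w → ∈-filterᵇ⁺ S (∈-allFin _) (all≡true⁻ S ⊆S v∈w))
                      (∈words⇒length (length (elems S)) w∈words) (∈-filterᵇ⁺ S (∈-allFin _) Sv)
        ; respects = λ Su Sv Guv → all≡true⁻ (λ e → beforeᵇ (proj₁ e) (proj₂ e) w) resp (∈edgesIn⁺ S Su Sv Guv) }
        where
        unique = nodupᵇ⇒Unique w nodup

      IsLinExt⇒∈linExts : {w : List (Fin n)} → IsLinExt S w → w ∈ linExts G S
      IsLinExt⇒∈linExts {w} le =
        ∈-filterᵇ⁺ (isLinExtᵇ G S) (subst (λ m → w ∈ words m) length≡ (length⇒∈words w))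
          (∧≡true⁺ (all≡true⁺ S w ⊆S)
            (∧≡true⁺ (Unique⇒nodupᵇ unique) (all≡true⁺ (λ e → beforeᵇ (proj₁ e) (proj₂ e) w) (edgesIn G S) λ {e} → respects′ e)))
        where
        open IsLinExt le
        length≡ : length w ≡ length (elems S)
        length≡ = ↭-length (Unique-⇔⇒↭ unique Unique-elems
          (mk⇔ (λ v∈w → ∈-filterᵇ⁺ S (∈-allFin _) (⊆S v∈w)) (⊇S ∘ proj₂ ∘ ∈-filterᵇ⁻ S (allFin n))))
        respects′ : ∀ e → e ∈ edgesIn G S → beforeᵇ (proj₁ e) (proj₂ e) w ≡ true
        respects′ (u , v) e∈ with Su , Sv , Guv ← ∈edgesIn⁻ S e∈ = respects Su Sv Guv

      Unique-linExts : Unique (linExts G S)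
      Unique-linExts = Unique-filterᵇ (isLinExtᵇ G S) (Unique-words (length (elems S)))

    module _ {S T : VSet n} (T⊆S : ∀ {v} → T v ≡ true → S v ≡ true) where

      IsLinExt-restrict : ∀ {w} → IsLinExt S w → IsLinExt T (filterᵇ T w)
      IsLinExt-restrict {w} le = record
        { unique   = Unique-filterᵇ T unique
        ; ⊆S       = proj₂ ∘ ∈-filterᵇ⁻ T w
        ; ⊇S       = λ Tv → ∈-filterᵇ⁺ T (⊇S (T⊆S Tv)) Tv
        ; respects = λ Tu Tv Guv → trans (beforeᵇ-filterᵇ T w Tu Tv) (respects (T⊆S Tu) (T⊆S Tv) Guv) }
        where open IsLinExt le

    IsLinExt-glue : {P Q S : VSet n} →
      (∀ {v} → S v ≡ true → P v ∨ Q v ≡ true) →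
      (∀ {u v} → S u ≡ true → S v ≡ true → G u v ≡ true →
         (P u ≡ true × P v ≡ true) ⊎ (Q u ≡ true × Q v ≡ true)) →
      ∀ {w} → Unique w → (∀ {v} → v ∈ w → S v ≡ true) →
      IsLinExt P (filterᵇ P w) → IsLinExt Q (filterᵇ Q w) → IsLinExt S w
    IsLinExt-glue {P} {Q} S⊆P∪Q edge-split {w} uw w⊆S leP leQ = record
      { unique   = uw
      ; ⊆S       = w⊆S
      ; ⊇S       = λ Sv → [ (λ Pv → proj₁ (∈-filterᵇ⁻ P w (IsLinExt.⊇S leP Pv)))
                          , (λ Qv → proj₁ (∈-filterᵇ⁻ Q w (IsLinExt.⊇S leQ Qv))) ]′ (∨≡true⁻ (S⊆P∪Q Sv))
      ; respects = λ Su Sv Guv → [ (λ (Pu , Pv) → trans (sym (beforeᵇ-filterᵇ P w Pu Pv)) (IsLinExt.respects leP Pu Pv Guv))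
                                 , (λ (Qu , Qv) → trans (sym (beforeᵇ-filterᵇ Q w Qu Qv)) (IsLinExt.respects leQ Qu Qv Guv))
                                 ]′ (edge-split Su Sv Guv) }

-- merge p q lists the shuffles of p and q in which each letter of C is taken from both words
-- at once; it is meant for words whose common letters are those of C, in the same order.
module Merge {n : ℕ} (C : VSet n) where

  merge : List (Fin n) → List (Fin n) → List (List (Fin n))
  merge []      q       = q ∷ []
  merge (a ∷ p) []      = (a ∷ p) ∷ []
  merge (a ∷ p) (b ∷ q) =
    if C a then (if C b then (if does (a ≟ᶠ b) then map (a ∷_) (merge p q) else [])
                 else map (b ∷_) (merge (a ∷ p) q))
    else (if C b then map (a ∷_) (merge p (b ∷ q))
          else map (a ∷_) (merge p (b ∷ q)) ++ map (b ∷_) (merge (a ∷ p) q))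

  merge-[] : (p : List (Fin n)) → merge p [] ≡ p ∷ []
  merge-[] []      = refl
  merge-[] (a ∷ p) = refl

  merge-complete : (P Q : VSet n) →
    (∀ {v} → C v ≡ true → P v ≡ true) → (∀ {v} → C v ≡ true → Q v ≡ true) →
    (∀ {v} → P v ≡ true → Q v ≡ true → C v ≡ true) →
    (w : List (Fin n)) → (∀ {v} → v ∈ w → P v ∨ Q v ≡ true) →
    w ∈ merge (filterᵇ P w) (filterᵇ Q w)
  merge-complete P Q C⊆P C⊆Q P∩Q⊆C [] _ = here refl
  merge-complete P Q C⊆P C⊆Q P∩Q⊆C (h ∷ w) w⊆P∪Q
    with merge-complete P Q C⊆P C⊆Q P∩Q⊆C w (w⊆P∪Q ∘ there) | P h in Ph | Q h in Qh
  ... | ih | true | true rewrite P∩Q⊆C Ph Qh with h ≟ᶠ h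
  ...   | yes _   = ∈-map⁺ (h ∷_) ih
  ...   | no h≢h  = ⊥-elim (h≢h refl)
  merge-complete P Q C⊆P C⊆Q P∩Q⊆C (h ∷ w) w⊆P∪Q | ih | true | false with filterᵇ Q w | ih
  ... | []     | ih′ rewrite merge-[] (filterᵇ P w) = here (cong (h ∷_) (∈-[y]⇒≡ ih′))
  ... | b ∷ fq | ih′ with C h in Ch | C b
  ...   | true  | _     = ⊥-elim (not-¬ (C⊆Q Ch) Qh)
  ...   | false | true  = ∈-map⁺ (h ∷_) ih′
  ...   | false | false = ∈-++⁺ˡ (∈-map⁺ (h ∷_) ih′)
  merge-complete P Q C⊆P C⊆Q P∩Q⊆C (h ∷ w) w⊆P∪Q | ih | false | true with filterᵇ P w | ih
  ... | []     | ih′ = here (cong (h ∷_) (∈-[y]⇒≡ ih′))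
  ... | a ∷ fp | ih′ with C h in Ch | C a
  ...   | true  | _     = ⊥-elim (not-¬ (C⊆P Ch) Ph)
  ...   | false | true  = ∈-map⁺ (h ∷_) ih′
  ...   | false | false = ∈-++⁺ʳ (map (a ∷_) (merge fp (h ∷ filterᵇ Q w))) (∈-map⁺ (h ∷_) ih′)
  merge-complete P Q C⊆P C⊆Q P∩Q⊆C (h ∷ w) w⊆P∪Q | ih | false | false
    with () ← trans (sym (w⊆P∪Q (here refl))) (cong₂ _∨_ Ph Qh)

  module _ {P Q : VSet n} where

    record Compatible (p q : List (Fin n)) : Set where
      field
        uniqueˡ   : Unique p
        uniqueʳ   : Unique q
        ⊆P        : ∀ {v} → v ∈ p → P v ≡ true
        ⊆Q        : ∀ {v} → v ∈ q → Q v ≡ true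
        Q≡C-on-p  : ∀ {v} → v ∈ p → Q v ≡ C v
        P≡C-on-q  : ∀ {v} → v ∈ q → P v ≡ C v
        sameChain : filterᵇ C p ≡ filterᵇ C q

    open Compatible

    common⇒C : ∀ {p q} → Compatible p q → ∀ {v} → v ∈ p → v ∈ q → C v ≡ true
    common⇒C g v∈p v∈q = trans (sym (Q≡C-on-p g v∈p)) (⊆Q g v∈q)

    ∉ʳ : ∀ {a p q} → Compatible (a ∷ p) q → C a ≡ false → a ∉ q
    ∉ʳ g Ca a∈q = not-¬ (⊆Q g a∈q) (trans (Q≡C-on-p g (here refl)) Ca)

    ∉ˡ : ∀ {b p q} → Compatible p (b ∷ q) → C b ≡ false → b ∉ p
    ∉ˡ g Cb b∈p = not-¬ (⊆P g b∈p) (trans (P≡C-on-q g (here refl)) Cb)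

    Compatible-∈∈ : ∀ {a p q} → Compatible (a ∷ p) (a ∷ q) → C a ≡ true → Compatible p q
    Compatible-∈∈ {p = p} {q} g Ca = record
      { uniqueˡ = Unique-tail (uniqueˡ g) ; uniqueʳ = Unique-tail (uniqueʳ g)
      ; ⊆P = ⊆P g ∘ there ; ⊆Q = ⊆Q g ∘ there
      ; Q≡C-on-p = Q≡C-on-p g ∘ there ; P≡C-on-q = P≡C-on-q g ∘ there
      ; sameChain = ∷-injectiveʳ (trans (sym (filterᵇ-accept C p Ca))
                                        (trans (sameChain g) (filterᵇ-accept C q Ca))) }

    Compatible-tailʳ : ∀ {a b p q} → Compatible (a ∷ p) (b ∷ q) → C b ≡ false → Compatible (a ∷ p) q
    Compatible-tailʳ {q = q} g Cb = record
      { uniqueˡ = uniqueˡ g ; uniqueʳ = Unique-tail (uniqueʳ g)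
      ; ⊆P = ⊆P g ; ⊆Q = ⊆Q g ∘ there
      ; Q≡C-on-p = Q≡C-on-p g ; P≡C-on-q = P≡C-on-q g ∘ there
      ; sameChain = trans (sameChain g) (filterᵇ-reject C q Cb) }

    Compatible-tailˡ : ∀ {a b p q} → Compatible (a ∷ p) (b ∷ q) → C a ≡ false → Compatible p (b ∷ q)
    Compatible-tailˡ {p = p} g Ca = record
      { uniqueˡ = Unique-tail (uniqueˡ g) ; uniqueʳ = uniqueʳ g
      ; ⊆P = ⊆P g ∘ there ; ⊆Q = ⊆Q g
      ; Q≡C-on-p = Q≡C-on-p g ∘ there ; P≡C-on-q = P≡C-on-q g
      ; sameChain = trans (sym (filterᵇ-reject C p Ca)) (sameChain g) }

    Compatible-heads : ∀ {a b p q} → Compatible (a ∷ p) (b ∷ q) → C a ≡ true → C b ≡ true → a ≡ b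
    Compatible-heads {p = p} {q} g Ca Cb =
      ∷-injectiveˡ (trans (sym (filterᵇ-accept C p Ca)) (trans (sameChain g) (filterᵇ-accept C q Cb)))

    sameChain-∉∈ : ∀ {a b p q} → Compatible (a ∷ p) (b ∷ q) → C a ≡ false → C b ≡ true →
      filterᵇ C p ≡ b ∷ filterᵇ C q
    sameChain-∉∈ {p = p} {q} g Ca Cb = trans (sym (filterᵇ-reject C p Ca)) (trans (sameChain g) (filterᵇ-accept C q Cb))

    record IsMergeOf (p q w : List (Fin n)) : Set where
      field
        unique    : Unique w
        ⊆p∪q      : ∀ {v} → v ∈ w → v ∈ p ⊎ v ∈ q
        restrictˡ : filterᵇ P w ≡ p
        restrictʳ : filterᵇ Q w ≡ q

    open IsMergeOf

    module _ {a : Fin n} {p q w : List (Fin n)} (a∉p : a ∉ p) (a∉q : a ∉ q) (m : IsMergeOf p q w) where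

      private
        a∉w : a ∉ w
        a∉w a∈w = [ a∉p , a∉q ]′ (⊆p∪q m a∈w)

      IsMergeOf-∷ᵇ : P a ≡ true → Q a ≡ true → IsMergeOf (a ∷ p) (a ∷ q) (a ∷ w)
      IsMergeOf-∷ᵇ Pa Qa = record
        { unique = Unique-∷ a∉w (unique m)
        ; ⊆p∪q = λ { (here refl) → inj₁ (here refl) ; (there v∈w) → ⊎-map there there (⊆p∪q m v∈w) }
        ; restrictˡ = trans (filterᵇ-accept P w Pa) (cong (a ∷_) (restrictˡ m))
        ; restrictʳ = trans (filterᵇ-accept Q w Qa) (cong (a ∷_) (restrictʳ m)) }

      IsMergeOf-∷ˡ : P a ≡ true → Q a ≡ false → IsMergeOf (a ∷ p) q (a ∷ w)
      IsMergeOf-∷ˡ Pa Qa = record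
        { unique = Unique-∷ a∉w (unique m)
        ; ⊆p∪q = λ { (here refl) → inj₁ (here refl) ; (there v∈w) → ⊎-map₁ there (⊆p∪q m v∈w) }
        ; restrictˡ = trans (filterᵇ-accept P w Pa) (cong (a ∷_) (restrictˡ m))
        ; restrictʳ = trans (filterᵇ-reject Q w Qa) (restrictʳ m) }

      IsMergeOf-∷ʳ : P a ≡ false → Q a ≡ true → IsMergeOf p (a ∷ q) (a ∷ w)
      IsMergeOf-∷ʳ Pa Qa = record
        { unique = Unique-∷ a∉w (unique m)
        ; ⊆p∪q = λ { (here refl) → inj₂ (here refl) ; (there v∈w) → ⊎-map₂ there (⊆p∪q m v∈w) }
        ; restrictˡ = trans (filterᵇ-reject P w Pa) (restrictˡ m)
        ; restrictʳ = trans (filterᵇ-accept Q w Qa) (cong (a ∷_) (restrictʳ m)) }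

    merge-sound : (p q : List (Fin n)) → Compatible p q → ∀ {w} → w ∈ merge p q → IsMergeOf p q w
    merge-sound [] q g (here refl) = record
      { unique = uniqueʳ g ; ⊆p∪q = inj₂
      ; restrictˡ = filterᵇ-none P q λ v∈q →
          trans (P≡C-on-q g v∈q) (filterᵇ≡[]⇒≡false C q (sym (sameChain g)) v∈q)
      ; restrictʳ = filterᵇ-all Q q (⊆Q g) }
    merge-sound (a ∷ p) [] g (here refl) = record
      { unique = uniqueˡ g ; ⊆p∪q = inj₁
      ; restrictˡ = filterᵇ-all P (a ∷ p) (⊆P g)
      ; restrictʳ = filterᵇ-none Q (a ∷ p) λ v∈p →
          trans (Q≡C-on-p g v∈p) (filterᵇ≡[]⇒≡false C (a ∷ p) (sameChain g) v∈p) }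
    merge-sound (a ∷ p) (b ∷ q) g w∈ with C a in Ca | C b in Cb
    ... | true | true with a ≟ᶠ b | w∈
    ...   | yes refl | w∈′ with _ , m , refl ← ∈-map⁻ (a ∷_) w∈′ =
      IsMergeOf-∷ᵇ (Unique[x∷xs]⇒x∉xs (uniqueˡ g)) (Unique[x∷xs]⇒x∉xs (uniqueʳ g))
        (merge-sound p q (Compatible-∈∈ g Ca) m) (⊆P g (here refl)) (⊆Q g (here refl))
    merge-sound (a ∷ p) (b ∷ q) g w∈ | true | false with _ , m , refl ← ∈-map⁻ (b ∷_) w∈ =
      IsMergeOf-∷ʳ (∉ˡ g Cb) (Unique[x∷xs]⇒x∉xs (uniqueʳ g))
        (merge-sound (a ∷ p) q (Compatible-tailʳ g Cb) m) (trans (P≡C-on-q g (here refl)) Cb) (⊆Q g (here refl))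
    merge-sound (a ∷ p) (b ∷ q) g w∈ | false | true with _ , m , refl ← ∈-map⁻ (a ∷_) w∈ =
      IsMergeOf-∷ˡ (Unique[x∷xs]⇒x∉xs (uniqueˡ g)) (∉ʳ g Ca)
        (merge-sound p (b ∷ q) (Compatible-tailˡ g Ca) m) (⊆P g (here refl)) (trans (Q≡C-on-p g (here refl)) Ca)
    merge-sound (a ∷ p) (b ∷ q) g w∈ | false | false with ∈-++⁻ (map (a ∷_) (merge p (b ∷ q))) w∈
    ... | inj₁ w∈ˡ with _ , m , refl ← ∈-map⁻ (a ∷_) w∈ˡ =
      IsMergeOf-∷ˡ (Unique[x∷xs]⇒x∉xs (uniqueˡ g)) (∉ʳ g Ca)
        (merge-sound p (b ∷ q) (Compatible-tailˡ g Ca) m) (⊆P g (here refl)) (trans (Q≡C-on-p g (here refl)) Ca)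
    ... | inj₂ w∈ʳ with _ , m , refl ← ∈-map⁻ (b ∷_) w∈ʳ =
      IsMergeOf-∷ʳ (∉ˡ g Cb) (Unique[x∷xs]⇒x∉xs (uniqueʳ g))
        (merge-sound (a ∷ p) q (Compatible-tailʳ g Cb) m) (trans (P≡C-on-q g (here refl)) Cb) (⊆Q g (here refl))

    heads-differ : ∀ {a b p q} {w : List (Fin n)} {L L′ : List (List (Fin n))} →
      Compatible (a ∷ p) (b ∷ q) → C a ≡ false →
      (∃ λ u → u ∈ L × w ≡ a ∷ u) → (∃ λ u → u ∈ L′ × w ≡ b ∷ u) → ⊥
    heads-differ g Ca (_ , _ , refl) (_ , _ , a∷u≡b∷u′) with refl ← ∷-injectiveˡ a∷u≡b∷u′ =
      not-¬ (common⇒C g (here refl) (here refl)) Ca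

    Unique-merge-∷ : ∀ {a b p q} → Compatible (a ∷ p) (b ∷ q) →
      (Compatible p q → Unique (merge p q)) →
      (Compatible p (b ∷ q) → Unique (merge p (b ∷ q))) →
      (Compatible (a ∷ p) q → Unique (merge (a ∷ p) q)) →
      Unique (merge (a ∷ p) (b ∷ q))
    Unique-merge-∷ {a} {b} g ih ihˡ ihʳ with C a in Ca | C b in Cb
    ... | true | true with a ≟ᶠ b
    ...   | yes refl = map⁺ ∷-injectiveʳ (ih (Compatible-∈∈ g Ca))
    ...   | no _     = []
    Unique-merge-∷ g ih ihˡ ihʳ | true | false = map⁺ ∷-injectiveʳ (ihʳ (Compatible-tailʳ g Cb))
    Unique-merge-∷ g ih ihˡ ihʳ | false | true = map⁺ ∷-injectiveʳ (ihˡ (Compatible-tailˡ g Ca))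
    Unique-merge-∷ {a} {b} g ih ihˡ ihʳ | false | false =
      ++⁺ (map⁺ ∷-injectiveʳ (ihˡ (Compatible-tailˡ g Ca))) (map⁺ ∷-injectiveʳ (ihʳ (Compatible-tailʳ g Cb)))
          λ (w∈ˡ , w∈ʳ) → heads-differ g Ca (∈-map⁻ (a ∷_) w∈ˡ) (∈-map⁻ (b ∷_) w∈ʳ)

    Unique-merge : (p q : List (Fin n)) → Compatible p q → Unique (merge p q)
    Unique-merge []      q       _ = [] ∷ []
    Unique-merge (a ∷ p) []      _ = [] ∷ []
    Unique-merge (a ∷ p) (b ∷ q) g =
      Unique-merge-∷ g (Unique-merge p q) (Unique-merge p (b ∷ q)) (Unique-merge (a ∷ p) q)

private variable I J : Set

sumℚ-map-++ : (f : I → ℚ) (xs ys : List I) →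
  sumℚ (map f (xs ++ ys)) ≡ sumℚ (map f xs) + sumℚ (map f ys)
sumℚ-map-++ f []       ys = sym (+-identityˡ _)
sumℚ-map-++ f (b ∷ xs) ys = trans (cong (f b +_) (sumℚ-map-++ f xs ys)) (sym (+-assoc (f b) _ _))

sumℚ-map-↭ : (f : I → ℚ) {xs ys : List I} → xs ↭ ys → sumℚ (map f xs) ≡ sumℚ (map f ys)
sumℚ-map-↭ f xs↭ys = foldr-commMonoid (setoid ℚ) +-0-isCommutativeMonoid (↭⇒↭ₛ (↭-map⁺ f xs↭ys))

prodℚ-map-↭ : (f : I → ℚ) {xs ys : List I} → xs ↭ ys → prodℚ (map f xs) ≡ prodℚ (map f ys)
prodℚ-map-↭ f xs↭ys = foldr-commMonoid (setoid ℚ) *-1-isCommutativeMonoid (↭⇒↭ₛ (↭-map⁺ f xs↭ys))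

sumℚ-map-cong : {f g : I → ℚ} (xs : List I) → (∀ {b} → b ∈ xs → f b ≡ g b) →
  sumℚ (map f xs) ≡ sumℚ (map g xs)
sumℚ-map-cong []       _   = refl
sumℚ-map-cong (b ∷ xs) f≗g = cong₂ _+_ (f≗g (here refl)) (sumℚ-map-cong xs (f≗g ∘ there))

sumℚ-map-*ˡ : (k : ℚ) (f : I → ℚ) (xs : List I) → sumℚ (map (λ b → k * f b) xs) ≡ k * sumℚ (map f xs)
sumℚ-map-*ˡ k f []       = sym (*-zeroʳ k)
sumℚ-map-*ˡ k f (b ∷ xs) = trans (cong (k * f b +_) (sumℚ-map-*ˡ k f xs)) (sym (*-distribˡ-+ k (f b) _))

sumℚ-map-*ʳ : (k : ℚ) (f : I → ℚ) (xs : List I) → sumℚ (map (λ b → f b * k) xs) ≡ sumℚ (map f xs) * k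
sumℚ-map-*ʳ k f []       = sym (*-zeroˡ k)
sumℚ-map-*ʳ k f (b ∷ xs) = trans (cong (f b * k +_) (sumℚ-map-*ʳ k f xs)) (sym (*-distribʳ-+ k (f b) _))

sumℚ-map-concatMap : (f : J → ℚ) (g : I → List J) (xs : List I) →
  sumℚ (map f (concatMap g xs)) ≡ sumℚ (map (λ b → sumℚ (map f (g b))) xs)
sumℚ-map-concatMap f g []       = refl
sumℚ-map-concatMap f g (b ∷ xs) =
  trans (sumℚ-map-++ f (g b) (concatMap g xs)) (cong (sumℚ (map f (g b)) +_) (sumℚ-map-concatMap f g xs))

sumℚ-map-product : (f : I → ℚ) (g : J → ℚ) (k : ℚ) (xs : List I) (ys : List J) →
  sumℚ (map (λ b → sumℚ (map (λ e → f b * g e * k) ys)) xs) ≡ sumℚ (map f xs) * sumℚ (map g ys) * k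
sumℚ-map-product f g k xs ys = begin
  sumℚ (map (λ b → sumℚ (map (λ e → f b * g e * k) ys)) xs)
    ≡⟨ sumℚ-map-cong xs (λ {b} _ → trans (sumℚ-map-*ʳ k (λ e → f b * g e) ys) (cong (_* k) (sumℚ-map-*ˡ (f b) g ys))) ⟩
  sumℚ (map (λ b → f b * sumℚ (map g ys) * k) xs)
    ≡⟨ sumℚ-map-*ʳ k (λ b → f b * sumℚ (map g ys)) xs ⟩
  sumℚ (map (λ b → f b * sumℚ (map g ys)) xs) * k
    ≡⟨ cong (_* k) (sumℚ-map-*ʳ (sumℚ (map g ys)) f xs) ⟩
  sumℚ (map f xs) * sumℚ (map g ys) * k ∎
  where open ≡-Reasoning

module _ {B : Set} (w : B → ℚ) where
  open ≡-Reasoning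

  prodℚ-filterᵇ : (B → Bool) → List B → ℚ
  prodℚ-filterᵇ h L = prodℚ (map w (filterᵇ h L))

  prodℚ-filterᵇ-∧-∨ : (f g : B → Bool) (L : List B) →
    prodℚ-filterᵇ f L * prodℚ-filterᵇ g L ≡ prodℚ-filterᵇ (λ e → f e ∧ g e) L * prodℚ-filterᵇ (λ e → f e ∨ g e) L
  prodℚ-filterᵇ-∧-∨ f g []      = refl
  prodℚ-filterᵇ-∧-∨ f g (e ∷ L) with ih ← prodℚ-filterᵇ-∧-∨ f g L | f e | g e
  ... | true  | true  = begin
    (w e * F) * (w e * G)   ≡⟨ solve 3 (λ W F G → (W :* F) :* (W :* G) := W :* (W :* (F :* G))) refl (w e) F G ⟩
    w e * (w e * (F * G))   ≡⟨ cong (λ r → w e * (w e * r)) ih ⟩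
    w e * (w e * (F∧ * F∨)) ≡⟨ solve 3 (λ W F G → W :* (W :* (F :* G)) := (W :* F) :* (W :* G)) refl (w e) F∧ F∨ ⟩
    (w e * F∧) * (w e * F∨) ∎
    where F = prodℚ-filterᵇ f L ; G = prodℚ-filterᵇ g L
          F∧ = prodℚ-filterᵇ (λ e → f e ∧ g e) L ; F∨ = prodℚ-filterᵇ (λ e → f e ∨ g e) L
  ... | true  | false = begin
    (w e * F) * G           ≡⟨ *-assoc (w e) F G ⟩
    w e * (F * G)           ≡⟨ cong (w e *_) ih ⟩
    w e * (F∧ * F∨)         ≡⟨ solve 3 (λ W F G → W :* (F :* G) := F :* (W :* G)) refl (w e) F∧ F∨ ⟩
    F∧ * (w e * F∨)         ∎
    where F = prodℚ-filterᵇ f L ; G = prodℚ-filterᵇ g L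
          F∧ = prodℚ-filterᵇ (λ e → f e ∧ g e) L ; F∨ = prodℚ-filterᵇ (λ e → f e ∨ g e) L
  ... | false | true  = begin
    F * (w e * G)           ≡⟨ solve 3 (λ W F G → F :* (W :* G) := W :* (F :* G)) refl (w e) F G ⟩
    w e * (F * G)           ≡⟨ cong (w e *_) ih ⟩
    w e * (F∧ * F∨)         ≡⟨ solve 3 (λ W F G → W :* (F :* G) := F :* (W :* G)) refl (w e) F∧ F∨ ⟩
    F∧ * (w e * F∨)         ∎
    where F = prodℚ-filterᵇ f L ; G = prodℚ-filterᵇ g L
          F∧ = prodℚ-filterᵇ (λ e → f e ∧ g e) L ; F∨ = prodℚ-filterᵇ (λ e → f e ∨ g e) L
  ... | false | false = ih

inv-inverseˡ : (y : ℚ) → y ≢ 0ℚ → inv y * y ≡ 1ℚ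
inv-inverseˡ y y≢0 with y ≟ℚ 0ℚ
... | yes y≡0 = ⊥-elim (y≢0 y≡0)
... | no y≢0′ = *-inverseˡ y {{≢-nonZero y≢0′}}

x-y≡0⇒x≡y : (p q : ℚ) → p - q ≡ 0ℚ → p ≡ q
x-y≡0⇒x≡y p q p-q≡0 = begin
  p             ≡⟨ solve 2 (λ p q → p := (p :- q) :+ q) refl p q ⟩
  (p - q) + q   ≡⟨ cong (_+ q) p-q≡0 ⟩
  0ℚ + q        ≡⟨ +-identityˡ q ⟩
  q             ∎
  where open ≡-Reasoning

*-by-1 : (r : ℚ) {u : ℚ} → u ≡ 1ℚ → r ≡ r * u
*-by-1 r u≡1 = trans (sym (*-identityʳ r)) (cong (r *_) (sym u≡1))

-- kAB plays the role of 1 / (A − B); only kAB * (A − B) = 1 is assumed, so the proofs are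
-- ring computations.
inverse-of-negation : {A B kAB kBA : ℚ} → kAB * (A - B) ≡ 1ℚ → kBA * (B - A) ≡ 1ℚ → kBA ≡ - kAB
inverse-of-negation {A} {B} {kAB} {kBA} kAB-inv kBA-inv = begin
  kBA                       ≡⟨ *-by-1 kBA kAB-inv ⟩
  kBA * (kAB * (A - B))     ≡⟨ solve 4 (λ kAB kBA A B → kBA :* (kAB :* (A :- B)) := (:- kAB) :* (kBA :* (B :- A))) refl kAB kBA A B ⟩
  (- kAB) * (kBA * (B - A)) ≡⟨ cong ((- kAB) *_) kBA-inv ⟩
  (- kAB) * 1ℚ              ≡⟨ *-identityʳ _ ⟩
  - kAB                     ∎
  where open ≡-Reasoning

-- Lagrange interpolation of the affine function y ↦ α y + β at the nodes A, B, evaluated at T.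
lagrange-affine : {T A B kTA kTB kAB kBA : ℚ} →
  kTA * (T - A) ≡ 1ℚ → kTB * (T - B) ≡ 1ℚ → kAB * (A - B) ≡ 1ℚ → kBA * (B - A) ≡ 1ℚ → (α β : ℚ) →
  kTA * kAB * (α * A + β) + kTB * kBA * (α * B + β) ≡ kTA * kTB * (α * T + β)
lagrange-affine {T} {A} {B} {kTA} {kTB} {kAB} {kBA} kTA-inv kTB-inv kAB-inv kBA-inv α β = begin
  kTA * kAB * fA + kTB * kBA * fB
    ≡⟨ cong (λ k → kTA * kAB * fA + kTB * k * fB) (inverse-of-negation {A} {B} {kAB} {kBA} kAB-inv kBA-inv) ⟩
  kTA * kAB * fA + kTB * (- kAB) * fB
    ≡⟨ cong₂ _+_ (*-by-1 (kTA * kAB * fA) kTB-inv) (*-by-1 (kTB * (- kAB) * fB) kTA-inv) ⟩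
  kTA * kAB * fA * (kTB * (T - B)) + kTB * (- kAB) * fB * (kTA * (T - A))
    ≡⟨ solve 8 (λ kTA kTB kAB α β T A B →
         kTA :* kAB :* (α :* A :+ β) :* (kTB :* (T :- B)) :+ kTB :* (:- kAB) :* (α :* B :+ β) :* (kTA :* (T :- A))
         := kTA :* kTB :* (α :* T :+ β) :* (kAB :* (A :- B))) refl kTA kTB kAB α β T A B ⟩
  kTA * kTB * fT * (kAB * (A - B))
    ≡⟨ sym (*-by-1 (kTA * kTB * fT) kAB-inv) ⟩
  kTA * kTB * fT ∎
  where
  open ≡-Reasoning
  fA = α * A + β
  fB = α * B + β
  fT = α * T + β

-- the same with the evaluation point T at infinity
lagrange-affine-leading : {A B kAB kBA : ℚ} → kAB * (A - B) ≡ 1ℚ → kBA * (B - A) ≡ 1ℚ → (α β : ℚ) →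
  kAB * (α * A + β) + kBA * (α * B + β) ≡ α
lagrange-affine-leading {A} {B} {kAB} {kBA} kAB-inv kBA-inv α β = begin
  kAB * (α * A + β) + kBA * (α * B + β)
    ≡⟨ cong (λ k → kAB * (α * A + β) + k * (α * B + β)) (inverse-of-negation {A} {B} {kAB} {kBA} kAB-inv kBA-inv) ⟩
  kAB * (α * A + β) + (- kAB) * (α * B + β)
    ≡⟨ solve 5 (λ kAB α β A B → kAB :* (α :* A :+ β) :+ (:- kAB) :* (α :* B :+ β) := α :* (kAB :* (A :- B))) refl kAB α β A B ⟩
  α * (kAB * (A - B))
    ≡⟨ sym (*-by-1 α kAB-inv) ⟩
  α ∎
  where open ≡-Reasoning

module Differences {n : ℕ} (x : Fin n → ℚ) where

  d : Fin n → Fin n → ℚ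
  d u v = x u - x v

  edgeDiff : Fin n × Fin n → ℚ
  edgeDiff (u , v) = d u v

  -- inv 0 = 0, so d⁻¹ u v inverts d u v only for x u ≠ x v
  d⁻¹ : Fin n → Fin n → ℚ
  d⁻¹ u v = inv (d u v)

  ψ : List (Fin n) → ℚ
  ψ = termΨ x

  Δ : List (Fin n) → ℚ
  Δ []          = 1ℚ
  Δ (a ∷ [])    = 1ℚ
  Δ (a ∷ b ∷ w) = d a b * Δ (b ∷ w)

  gap : Fin n → List (Fin n) → ℚ
  gap u []      = 1ℚ
  gap u (z ∷ _) = d u z

  gap-affine : (c : List (Fin n)) → ∃ λ α → ∃ λ β → ∀ u → gap u c ≡ α * x u + β
  gap-affine []      = 0ℚ , 1ℚ , λ u → solve 1 (λ X → con 1ℚ := con 0ℚ :* X :+ con 1ℚ) refl (x u)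
  gap-affine (z ∷ _) = 1ℚ , - x z , λ u → solve 2 (λ X Z → X :- Z := con 1ℚ :* X :+ (:- Z)) refl (x u) (x z)

  Δ-∷ : (u : Fin n) (c : List (Fin n)) → Δ (u ∷ c) ≡ gap u c * Δ c
  Δ-∷ u []      = sym (*-identityʳ 1ℚ)
  Δ-∷ u (z ∷ c) = refl

  module Injectivity (x-injective : Injective _≡_ _≡_ x) where

    d⁻¹-inverse : {u v : Fin n} → u ≢ v → d⁻¹ u v * d u v ≡ 1ℚ
    d⁻¹-inverse {u} {v} u≢v = inv-inverseˡ (d u v) (u≢v ∘ x-injective ∘ x-y≡0⇒x≡y (x u) (x v))

    ψ*Δ≡1 : {w : List (Fin n)} → Unique w → ψ w * Δ w ≡ 1ℚ
    ψ*Δ≡1 {[]}        _              = *-identityʳ 1ℚ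
    ψ*Δ≡1 {a ∷ []}    _              = *-identityʳ 1ℚ
    ψ*Δ≡1 {a ∷ b ∷ w} uw@(_ ∷ uw′) = begin
      (d⁻¹ a b * ψ (b ∷ w)) * (d a b * Δ (b ∷ w))
        ≡⟨ solve 4 (λ k e P Q → (k :* P) :* (e :* Q) := (k :* e) :* (P :* Q)) refl (d⁻¹ a b) (d a b) (ψ (b ∷ w)) (Δ (b ∷ w)) ⟩
      (d⁻¹ a b * d a b) * (ψ (b ∷ w) * Δ (b ∷ w))
        ≡⟨ cong₂ _*_ (d⁻¹-inverse (λ { refl → Unique[x∷xs]⇒x∉xs uw (here refl) })) (ψ*Δ≡1 uw′) ⟩
      1ℚ * 1ℚ ≡⟨ *-identityʳ 1ℚ ⟩
      1ℚ ∎
      where open ≡-Reasoning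

module MergeSum {n : ℕ} (x : Fin n → ℚ) (x-injective : Injective _≡_ _≡_ x) (C : VSet n) where
  open Differences x
  open Injectivity x-injective
  open Merge C
  open ≡-Reasoning

  Φ : Fin n → List (Fin n) → List (Fin n) → List (Fin n) → ℚ
  Φ t p q c = ψ (t ∷ p) * ψ (t ∷ q) * Δ (t ∷ c)

  Φ₀ : List (Fin n) → List (Fin n) → List (Fin n) → ℚ
  Φ₀ p q c = ψ p * ψ q * Δ c

  Φ-comm : ∀ t p q c → Φ t p q c ≡ Φ t q p c
  Φ-comm t p q c = cong (_* Δ (t ∷ c)) (*-comm (ψ (t ∷ p)) (ψ (t ∷ q)))

  Φ-∈∈ : ∀ {t a} p q c → t ≢ a → d⁻¹ t a * Φ a p q c ≡ Φ t (a ∷ p) (a ∷ q) (a ∷ c)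
  Φ-∈∈ {t} {a} p q c t≢a = begin
    k * (X * Y * K)              ≡⟨ *-by-1 _ (d⁻¹-inverse t≢a) ⟩
    k * (X * Y * K) * (k * d t a) ≡⟨ solve 5 (λ k e X Y K → k :* (X :* Y :* K) :* (k :* e) := (k :* X) :* (k :* Y) :* (e :* K)) refl k (d t a) X Y K ⟩
    (k * X) * (k * Y) * (d t a * K) ∎
    where k = d⁻¹ t a ; X = ψ (a ∷ p) ; Y = ψ (a ∷ q) ; K = Δ (a ∷ c)

  Φ-∈∉ : ∀ {t a b} p q c → t ≢ a → b ≢ a → d⁻¹ t b * Φ b (a ∷ p) q (a ∷ c) ≡ Φ t (a ∷ p) (b ∷ q) (a ∷ c)
  Φ-∈∉ {t} {a} {b} p q c t≢a b≢a = begin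
    d⁻¹ t b * ((d⁻¹ b a * X) * Y * (d b a * K))
      ≡⟨ solve 6 (λ k k′ e′ X Y K → k :* ((k′ :* X) :* Y :* (e′ :* K)) := k :* X :* Y :* K :* (k′ :* e′)) refl (d⁻¹ t b) (d⁻¹ b a) (d b a) X Y K ⟩
    d⁻¹ t b * X * Y * K * (d⁻¹ b a * d b a)
      ≡⟨ cong (d⁻¹ t b * X * Y * K *_) (trans (d⁻¹-inverse b≢a) (sym (d⁻¹-inverse t≢a))) ⟩
    d⁻¹ t b * X * Y * K * (d⁻¹ t a * d t a)
      ≡⟨ solve 6 (λ k k′ e′ X Y K → k :* X :* Y :* K :* (k′ :* e′) := (k′ :* X) :* (k :* Y) :* (e′ :* K)) refl (d⁻¹ t b) (d⁻¹ t a) (d t a) X Y K ⟩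
    (d⁻¹ t a * X) * (d⁻¹ t b * Y) * (d t a * K) ∎
    where X = ψ (a ∷ p) ; Y = ψ (b ∷ q) ; K = Δ (a ∷ c)

  Φ-∉∈ : ∀ {t a b} p q c → t ≢ b → a ≢ b → d⁻¹ t a * Φ a p (b ∷ q) (b ∷ c) ≡ Φ t (a ∷ p) (b ∷ q) (b ∷ c)
  Φ-∉∈ {t} {a} {b} p q c t≢b a≢b = begin
    d⁻¹ t a * Φ a p (b ∷ q) (b ∷ c) ≡⟨ cong (d⁻¹ t a *_) (Φ-comm a p (b ∷ q) (b ∷ c)) ⟩
    d⁻¹ t a * Φ a (b ∷ q) p (b ∷ c) ≡⟨ Φ-∈∉ {t} {b} {a} q p c t≢b a≢b ⟩
    Φ t (b ∷ q) (a ∷ p) (b ∷ c)     ≡⟨ Φ-comm t (b ∷ q) (a ∷ p) (b ∷ c) ⟩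
    Φ t (a ∷ p) (b ∷ q) (b ∷ c)     ∎

  Φ-∉∉ : ∀ {t a b} p q c → t ≢ a → t ≢ b → a ≢ b →
    d⁻¹ t a * Φ a p (b ∷ q) c + d⁻¹ t b * Φ b (a ∷ p) q c ≡ Φ t (a ∷ p) (b ∷ q) c
  Φ-∉∉ {t} {a} {b} p q c t≢a t≢b a≢b with α , β , gap≡ ← gap-affine c = begin
    d⁻¹ t a * (X * (d⁻¹ a b * Y) * Δ (a ∷ c)) + d⁻¹ t b * ((d⁻¹ b a * X) * Y * Δ (b ∷ c))
      ≡⟨ cong₂ (λ u v → d⁻¹ t a * (X * (d⁻¹ a b * Y) * u) + d⁻¹ t b * ((d⁻¹ b a * X) * Y * v))
               (trans (Δ-∷ a c) (cong (_* K) (gap≡ a))) (trans (Δ-∷ b c) (cong (_* K) (gap≡ b))) ⟩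
    d⁻¹ t a * (X * (d⁻¹ a b * Y) * (fa * K)) + d⁻¹ t b * ((d⁻¹ b a * X) * Y * (fb * K))
      ≡⟨ solve 9 (λ kta ktb kab kba fa fb X Y K →
           kta :* (X :* (kab :* Y) :* (fa :* K)) :+ ktb :* ((kba :* X) :* Y :* (fb :* K))
           := (kta :* kab :* fa :+ ktb :* kba :* fb) :* X :* Y :* K)
           refl (d⁻¹ t a) (d⁻¹ t b) (d⁻¹ a b) (d⁻¹ b a) fa fb X Y K ⟩
    (d⁻¹ t a * d⁻¹ a b * fa + d⁻¹ t b * d⁻¹ b a * fb) * X * Y * K
      ≡⟨ cong (λ r → r * X * Y * K)
           (lagrange-affine {x t} {x a} {x b} {d⁻¹ t a} {d⁻¹ t b} {d⁻¹ a b} {d⁻¹ b a} (d⁻¹-inverse t≢a) (d⁻¹-inverse t≢b) (d⁻¹-inverse a≢b) (d⁻¹-inverse (a≢b ∘ sym)) α β) ⟩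
    d⁻¹ t a * d⁻¹ t b * ft * X * Y * K
      ≡⟨ solve 6 (λ kta ktb ft X Y K → kta :* ktb :* ft :* X :* Y :* K := (kta :* X) :* (ktb :* Y) :* (ft :* K))
           refl (d⁻¹ t a) (d⁻¹ t b) ft X Y K ⟩
    (d⁻¹ t a * X) * (d⁻¹ t b * Y) * (ft * K)
      ≡⟨ cong (λ g → (d⁻¹ t a * X) * (d⁻¹ t b * Y) * (g * K)) (sym (gap≡ t)) ⟩
    (d⁻¹ t a * X) * (d⁻¹ t b * Y) * (gap t c * K)
      ≡⟨ cong ((d⁻¹ t a * X) * (d⁻¹ t b * Y) *_) (sym (Δ-∷ t c)) ⟩
    Φ t (a ∷ p) (b ∷ q) c ∎
    where X = ψ (a ∷ p) ; Y = ψ (b ∷ q) ; K = Δ c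
          fa = α * x a + β ; fb = α * x b + β ; ft = α * x t + β

  Φ₀-∈∉ : ∀ {a b} p q c → b ≢ a → Φ b (a ∷ p) q (a ∷ c) ≡ Φ₀ (a ∷ p) (b ∷ q) (a ∷ c)
  Φ₀-∈∉ {a} {b} p q c b≢a = begin
    (d⁻¹ b a * X) * Y * (d b a * K)  ≡⟨ solve 5 (λ k e X Y K → (k :* X) :* Y :* (e :* K) := X :* Y :* K :* (k :* e)) refl (d⁻¹ b a) (d b a) X Y K ⟩
    X * Y * K * (d⁻¹ b a * d b a)    ≡⟨ sym (*-by-1 (X * Y * K) (d⁻¹-inverse b≢a)) ⟩
    X * Y * K                        ∎
    where X = ψ (a ∷ p) ; Y = ψ (b ∷ q) ; K = Δ (a ∷ c)

  Φ₀-∉∈ : ∀ {a b} p q c → a ≢ b → Φ a p (b ∷ q) (b ∷ c) ≡ Φ₀ (a ∷ p) (b ∷ q) (b ∷ c)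
  Φ₀-∉∈ {a} {b} p q c a≢b = begin
    Φ a p (b ∷ q) (b ∷ c)        ≡⟨ Φ-comm a p (b ∷ q) (b ∷ c) ⟩
    Φ a (b ∷ q) p (b ∷ c)        ≡⟨ Φ₀-∈∉ q p c a≢b ⟩
    Φ₀ (b ∷ q) (a ∷ p) (b ∷ c)   ≡⟨ cong (_* Δ (b ∷ c)) (*-comm (ψ (b ∷ q)) (ψ (a ∷ p))) ⟩
    Φ₀ (a ∷ p) (b ∷ q) (b ∷ c)   ∎

  Φ₀-∉∉ : ∀ {a b} p q z c → a ≢ b →
    Φ a p (b ∷ q) (z ∷ c) + Φ b (a ∷ p) q (z ∷ c) ≡ Φ₀ (a ∷ p) (b ∷ q) (z ∷ c)
  Φ₀-∉∉ {a} {b} p q z c a≢b = begin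
    X * (d⁻¹ a b * Y) * (d a z * K) + (d⁻¹ b a * X) * Y * (d b z * K)
      ≡⟨ solve 8 (λ kab kba A B Z X Y K →
           X :* (kab :* Y) :* ((A :- Z) :* K) :+ (kba :* X) :* Y :* ((B :- Z) :* K)
           := (kab :* (con 1ℚ :* A :+ (:- Z)) :+ kba :* (con 1ℚ :* B :+ (:- Z))) :* (X :* Y :* K))
           refl (d⁻¹ a b) (d⁻¹ b a) (x a) (x b) (x z) X Y K ⟩
    (d⁻¹ a b * (1ℚ * x a + - x z) + d⁻¹ b a * (1ℚ * x b + - x z)) * (X * Y * K)
      ≡⟨ cong (_* (X * Y * K))
           (lagrange-affine-leading {x a} {x b} {d⁻¹ a b} {d⁻¹ b a} (d⁻¹-inverse a≢b) (d⁻¹-inverse (a≢b ∘ sym)) 1ℚ (- x z)) ⟩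
    1ℚ * (X * Y * K)
      ≡⟨ *-identityˡ _ ⟩
    X * Y * K ∎
    where X = ψ (a ∷ p) ; Y = ψ (b ∷ q) ; K = Δ (z ∷ c)

  Σψ∷ : Fin n → List (List (Fin n)) → ℚ
  Σψ∷ t L = sumℚ (map (λ w → ψ (t ∷ w)) L)

  Σψ∷-map∷ : (t a : Fin n) (L : List (List (Fin n))) → Σψ∷ t (map (a ∷_) L) ≡ d⁻¹ t a * Σψ∷ a L
  Σψ∷-map∷ t a L = trans (cong sumℚ (sym (map-∘ L))) (sumℚ-map-*ˡ (d⁻¹ t a) (λ w → ψ (a ∷ w)) L)

  Σψ-map∷ : (a : Fin n) (L : List (List (Fin n))) → sumℚ (map ψ (map (a ∷_) L)) ≡ Σψ∷ a L
  Σψ-map∷ a L = cong sumℚ (sym (map-∘ L))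

  module _ {P Q : VSet n} where
    open Compatible

    MergeFormula : List (Fin n) → List (Fin n) → Set
    MergeFormula p q = Compatible {P = P} {Q} p q → ∀ {t} → t ∉ p → t ∉ q → Σψ∷ t (merge p q) ≡ Φ t p q (filterᵇ C p)

    Σψ∷-merge-∷ : ∀ {a b p q} → MergeFormula p q → MergeFormula p (b ∷ q) → MergeFormula (a ∷ p) q →
      MergeFormula (a ∷ p) (b ∷ q)
    Σψ∷-merge-∷ {a} {b} {p} {q} ih ihˡ ihʳ g {t} t∉a∷p t∉b∷q with C a in Ca | C b in Cb
    ... | true | true with refl ← Compatible-heads g Ca Cb with a ≟ᶠ a
    ...   | no a≢a = ⊥-elim (a≢a refl)
    ...   | yes _  = begin
      Σψ∷ t (map (a ∷_) (merge p q))         ≡⟨ Σψ∷-map∷ t a (merge p q) ⟩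
      d⁻¹ t a * Σψ∷ a (merge p q)            ≡⟨ cong (d⁻¹ t a *_) (ih (Compatible-∈∈ g Ca) a∉p (Unique[x∷xs]⇒x∉xs (uniqueʳ g))) ⟩
      d⁻¹ t a * Φ a p q (filterᵇ C p)        ≡⟨ Φ-∈∈ p q (filterᵇ C p) (t∉a∷p ∘ here) ⟩
      Φ t (a ∷ p) (a ∷ q) (a ∷ filterᵇ C p)  ∎
      where a∉p = Unique[x∷xs]⇒x∉xs (uniqueˡ g)
    Σψ∷-merge-∷ {a} {b} {p} {q} ih ihˡ ihʳ g {t} t∉a∷p t∉b∷q | true | false = begin
      Σψ∷ t (map (b ∷_) (merge (a ∷ p) q))           ≡⟨ Σψ∷-map∷ t b (merge (a ∷ p) q) ⟩
      d⁻¹ t b * Σψ∷ b (merge (a ∷ p) q)              ≡⟨ cong (d⁻¹ t b *_) (ihʳ (Compatible-tailʳ g Cb) (∉ˡ g Cb) (Unique[x∷xs]⇒x∉xs (uniqueʳ g))) ⟩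
      d⁻¹ t b * Φ b (a ∷ p) q (a ∷ filterᵇ C p)      ≡⟨ Φ-∈∉ p q (filterᵇ C p) (t∉a∷p ∘ here) (λ { refl → not-¬ Ca Cb }) ⟩
      Φ t (a ∷ p) (b ∷ q) (a ∷ filterᵇ C p)          ∎
    Σψ∷-merge-∷ {a} {b} {p} {q} ih ihˡ ihʳ g {t} t∉a∷p t∉b∷q | false | true = begin
      Σψ∷ t (map (a ∷_) (merge p (b ∷ q)))           ≡⟨ Σψ∷-map∷ t a (merge p (b ∷ q)) ⟩
      d⁻¹ t a * Σψ∷ a (merge p (b ∷ q))              ≡⟨ cong (d⁻¹ t a *_) (ihˡ (Compatible-tailˡ g Ca) (Unique[x∷xs]⇒x∉xs (uniqueˡ g)) (∉ʳ g Ca)) ⟩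
      d⁻¹ t a * Φ a p (b ∷ q) (filterᵇ C p)          ≡⟨ cong (λ c → d⁻¹ t a * Φ a p (b ∷ q) c) (sameChain-∉∈ g Ca Cb) ⟩
      d⁻¹ t a * Φ a p (b ∷ q) (b ∷ filterᵇ C q)      ≡⟨ Φ-∉∈ p q (filterᵇ C q) (t∉b∷q ∘ here) (λ { refl → not-¬ Cb Ca }) ⟩
      Φ t (a ∷ p) (b ∷ q) (b ∷ filterᵇ C q)          ≡⟨ cong (Φ t (a ∷ p) (b ∷ q)) (sym (sameChain-∉∈ g Ca Cb)) ⟩
      Φ t (a ∷ p) (b ∷ q) (filterᵇ C p)              ∎
    Σψ∷-merge-∷ {a} {b} {p} {q} ih ihˡ ihʳ g {t} t∉a∷p t∉b∷q | false | false = begin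
      Σψ∷ t (map (a ∷_) (merge p (b ∷ q)) ++ map (b ∷_) (merge (a ∷ p) q))
        ≡⟨ sumℚ-map-++ (λ w → ψ (t ∷ w)) (map (a ∷_) (merge p (b ∷ q))) (map (b ∷_) (merge (a ∷ p) q)) ⟩
      Σψ∷ t (map (a ∷_) (merge p (b ∷ q))) + Σψ∷ t (map (b ∷_) (merge (a ∷ p) q))
        ≡⟨ cong₂ _+_ (Σψ∷-map∷ t a (merge p (b ∷ q))) (Σψ∷-map∷ t b (merge (a ∷ p) q)) ⟩
      d⁻¹ t a * Σψ∷ a (merge p (b ∷ q)) + d⁻¹ t b * Σψ∷ b (merge (a ∷ p) q)
        ≡⟨ cong₂ (λ u v → d⁻¹ t a * u + d⁻¹ t b * v)
             (ihˡ (Compatible-tailˡ g Ca) (Unique[x∷xs]⇒x∉xs (uniqueˡ g)) (∉ʳ g Ca))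
             (ihʳ (Compatible-tailʳ g Cb) (∉ˡ g Cb) (Unique[x∷xs]⇒x∉xs (uniqueʳ g))) ⟩
      d⁻¹ t a * Φ a p (b ∷ q) (filterᵇ C p) + d⁻¹ t b * Φ b (a ∷ p) q (filterᵇ C p)
        ≡⟨ Φ-∉∉ p q (filterᵇ C p) (t∉a∷p ∘ here) (t∉b∷q ∘ here) (λ { refl → ∉ʳ g Ca (here refl) }) ⟩
      Φ t (a ∷ p) (b ∷ q) (filterᵇ C p) ∎

    Σψ∷-merge : (p q : List (Fin n)) → MergeFormula p q
    Σψ∷-merge [] q g {t} _ _ = begin
      ψ (t ∷ q) + 0ℚ            ≡⟨ +-identityʳ _ ⟩
      ψ (t ∷ q)                 ≡⟨ solve 1 (λ Y → Y := con 1ℚ :* Y :* con 1ℚ) refl (ψ (t ∷ q)) ⟩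
      1ℚ * ψ (t ∷ q) * 1ℚ       ∎
    Σψ∷-merge (a ∷ p) [] g {t} _ _ = begin
      ψ (t ∷ a ∷ p) + 0ℚ                                   ≡⟨ +-identityʳ _ ⟩
      ψ (t ∷ a ∷ p)                                        ≡⟨ solve 1 (λ X → X := X :* con 1ℚ :* con 1ℚ) refl (ψ (t ∷ a ∷ p)) ⟩
      ψ (t ∷ a ∷ p) * 1ℚ * Δ (t ∷ [])                      ≡⟨ cong (λ c → ψ (t ∷ a ∷ p) * 1ℚ * Δ (t ∷ c)) (sym (sameChain g)) ⟩
      ψ (t ∷ a ∷ p) * ψ (t ∷ []) * Δ (t ∷ filterᵇ C (a ∷ p)) ∎
    Σψ∷-merge (a ∷ p) (b ∷ q) = Σψ∷-merge-∷ (Σψ∷-merge p q) (Σψ∷-merge p (b ∷ q)) (Σψ∷-merge (a ∷ p) q)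

    Σψ-merge : (p q : List (Fin n)) → Compatible {P = P} {Q} p q → filterᵇ C p ≢ [] →
      sumℚ (map ψ (merge p q)) ≡ Φ₀ p q (filterᵇ C p)
    Σψ-merge []      q  g c≢[] = ⊥-elim (c≢[] refl)
    Σψ-merge (a ∷ p) [] g c≢[] = ⊥-elim (c≢[] (sameChain g))
    Σψ-merge (a ∷ p) (b ∷ q) g c≢[] with C a in Ca | C b in Cb
    ... | true | true with refl ← Compatible-heads g Ca Cb with a ≟ᶠ a
    ...   | no a≢a = ⊥-elim (a≢a refl)
    ...   | yes _  =
      trans (Σψ-map∷ a (merge p q))
            (Σψ∷-merge p q (Compatible-∈∈ g Ca) (Unique[x∷xs]⇒x∉xs (uniqueˡ g)) (Unique[x∷xs]⇒x∉xs (uniqueʳ g)))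
    Σψ-merge (a ∷ p) (b ∷ q) g c≢[] | true | false = begin
      sumℚ (map ψ (map (b ∷_) (merge (a ∷ p) q)))  ≡⟨ Σψ-map∷ b (merge (a ∷ p) q) ⟩
      Σψ∷ b (merge (a ∷ p) q)                      ≡⟨ Σψ∷-merge (a ∷ p) q (Compatible-tailʳ g Cb) (∉ˡ g Cb) (Unique[x∷xs]⇒x∉xs (uniqueʳ g)) ⟩
      Φ b (a ∷ p) q (filterᵇ C (a ∷ p))            ≡⟨ cong (Φ b (a ∷ p) q) (filterᵇ-accept C p Ca) ⟩
      Φ b (a ∷ p) q (a ∷ filterᵇ C p)              ≡⟨ Φ₀-∈∉ p q (filterᵇ C p) (λ { refl → not-¬ Ca Cb }) ⟩
      Φ₀ (a ∷ p) (b ∷ q) (a ∷ filterᵇ C p)         ∎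
    Σψ-merge (a ∷ p) (b ∷ q) g c≢[] | false | true = begin
      sumℚ (map ψ (map (a ∷_) (merge p (b ∷ q))))  ≡⟨ Σψ-map∷ a (merge p (b ∷ q)) ⟩
      Σψ∷ a (merge p (b ∷ q))                      ≡⟨ Σψ∷-merge p (b ∷ q) (Compatible-tailˡ g Ca) (Unique[x∷xs]⇒x∉xs (uniqueˡ g)) (∉ʳ g Ca) ⟩
      Φ a p (b ∷ q) (filterᵇ C p)                  ≡⟨ cong (Φ a p (b ∷ q)) (sameChain-∉∈ g Ca Cb) ⟩
      Φ a p (b ∷ q) (b ∷ filterᵇ C q)              ≡⟨ Φ₀-∉∈ p q (filterᵇ C q) (λ { refl → not-¬ Cb Ca }) ⟩
      Φ₀ (a ∷ p) (b ∷ q) (b ∷ filterᵇ C q)         ≡⟨ cong (Φ₀ (a ∷ p) (b ∷ q)) (sym (sameChain-∉∈ g Ca Cb)) ⟩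
      Φ₀ (a ∷ p) (b ∷ q) (filterᵇ C p)             ∎
    Σψ-merge (a ∷ p) (b ∷ q) g c≢[] | false | false with filterᵇ C p in c≡ | c≢[]
    ... | []    | c≢[]′ = ⊥-elim (c≢[]′ refl)
    ... | z ∷ c | _     = begin
      sumℚ (map ψ (map (a ∷_) (merge p (b ∷ q)) ++ map (b ∷_) (merge (a ∷ p) q)))
        ≡⟨ sumℚ-map-++ ψ (map (a ∷_) (merge p (b ∷ q))) (map (b ∷_) (merge (a ∷ p) q)) ⟩
      sumℚ (map ψ (map (a ∷_) (merge p (b ∷ q)))) + sumℚ (map ψ (map (b ∷_) (merge (a ∷ p) q)))
        ≡⟨ cong₂ _+_ (Σψ-map∷ a (merge p (b ∷ q))) (Σψ-map∷ b (merge (a ∷ p) q)) ⟩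
      Σψ∷ a (merge p (b ∷ q)) + Σψ∷ b (merge (a ∷ p) q)
        ≡⟨ cong₂ _+_ (Σψ∷-merge p (b ∷ q) (Compatible-tailˡ g Ca) (Unique[x∷xs]⇒x∉xs (uniqueˡ g)) (∉ʳ g Ca))
                     (trans (Σψ∷-merge (a ∷ p) q (Compatible-tailʳ g Cb) (∉ˡ g Cb) (Unique[x∷xs]⇒x∉xs (uniqueʳ g)))
                            (cong (Φ b (a ∷ p) q) (filterᵇ-reject C p Ca))) ⟩
      Φ a p (b ∷ q) (filterᵇ C p) + Φ b (a ∷ p) q (filterᵇ C p)
        ≡⟨ cong (λ c → Φ a p (b ∷ q) c + Φ b (a ∷ p) q c) c≡ ⟩
      Φ a p (b ∷ q) (z ∷ c) + Φ b (a ∷ p) q (z ∷ c)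
        ≡⟨ Φ₀-∉∉ p q z c (λ { refl → ∉ʳ g Ca (here refl) }) ⟩
      Φ₀ (a ∷ p) (b ∷ q) (z ∷ c) ∎

module Chains {n : ℕ} (G : Graph n) where

  Consec-Adjacent⇒Edge : {c : List (Fin n)} {u v : Fin n} → Consec G c → Adjacent c u v → G u v ≡ true
  Consec-Adjacent⇒Edge (c-cons _ _ _ e _) adj-here      = e
  Consec-Adjacent⇒Edge (c-cons _ _ _ _ k) (adj-there s) = Consec-Adjacent⇒Edge k s

  Consec-++⁻ʳ : (α : List (Fin n)) {l : List (Fin n)} → Consec G (α ++ l) → Consec G l
  Consec-++⁻ʳ []                k                  = k
  Consec-++⁻ʳ (a ∷ [])          (c-one _)          = c-nil
  Consec-++⁻ʳ (a ∷ [])          (c-cons _ _ _ _ k) = k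
  Consec-++⁻ʳ (a ∷ α@(_ ∷ _))   (c-cons _ _ _ _ k) = Consec-++⁻ʳ α k

  Consec-++⁻ˡ : (l : List (Fin n)) {r : List (Fin n)} → Consec G (l ++ r) → Consec G l
  Consec-++⁻ˡ []          _                  = c-nil
  Consec-++⁻ˡ (a ∷ [])    _                  = c-one a
  Consec-++⁻ˡ (a ∷ b ∷ l) (c-cons _ _ _ e k) = c-cons a b l e (Consec-++⁻ˡ (b ∷ l) k)

  Unique-++⁻ʳ : (α : List (Fin n)) {l : List (Fin n)} → Unique (α ++ l) → Unique l
  Unique-++⁻ʳ []      u       = u
  Unique-++⁻ʳ (a ∷ α) (_ ∷ u) = Unique-++⁻ʳ α u

  Unique-++⁻ˡ : (l : List (Fin n)) {r : List (Fin n)} → Unique (l ++ r) → Unique l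
  Unique-++⁻ˡ []      _           = []
  Unique-++⁻ˡ (a ∷ l) u@(_ ∷ u′) = Unique-∷ (Unique[x∷xs]⇒x∉xs u ∘ ∈-++⁺ˡ) (Unique-++⁻ˡ l u′)

  infix-of-chain : (α s β : List (Fin n)) → Unique (α ++ s ++ β) → Consec G (α ++ s ++ β) →
    Unique s × Consec G s
  infix-of-chain α s β u k = Unique-++⁻ˡ s (Unique-++⁻ʳ α u) , Consec-++⁻ˡ s (Consec-++⁻ʳ α k)

  Last-∷ʳ : (v u : Fin n) (l : List (Fin n)) → Last G (v ∷ l ++ u ∷ []) u
  Last-∷ʳ v u []      = l-cons v (u ∷ []) u (l-one u)
  Last-∷ʳ v u (a ∷ l) = l-cons v (a ∷ l ++ u ∷ []) u (Last-∷ʳ a u l)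

  Adjacent-++ : (α : List (Fin n)) {u v : Fin n} {β : List (Fin n)} → Adjacent (α ++ u ∷ v ∷ β) u v
  Adjacent-++ []      = adj-here
  Adjacent-++ (a ∷ α) = adj-there (Adjacent-++ α)

  -- An edge going backwards along c closes a circuit; one skipping vertices is a transitivity edge.
  edge-in-chain⇒Adjacent : ¬ HasCircuit G → (∀ u v → ¬ TransitivityEdge G u v) →
    {c : List (Fin n)} → Unique c → Consec G c →
    ∀ {u v} → u ∈ c → v ∈ c → G u v ≡ true → Adjacent c u v
  edge-in-chain⇒Adjacent no-circuit no-trans uc kc {u} {v} u∈c v∈c Guv
    with α , β , refl ← ∈-∃++ u∈c with ∈-delete α β v∈c
  ... | inj₁ refl = ⊥-elim (no-circuit (u , [] , u , [] ∷ [] , c-one u , l-one u , Guv))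
  ... | inj₂ v∈αβ with ∈-++⁻ α v∈αβ
  ...   | inj₂ v∈β with ∈-∃++ v∈β
  ...     | [] , β₂ , refl = Adjacent-++ α
  ...     | m ∷ β₁ , β₂ , refl =
    let seg = u ∷ (m ∷ β₁) ++ v ∷ []
        c≡  = cong (λ l → α ++ u ∷ l) (sym (++-assoc (m ∷ β₁) (v ∷ []) β₂))
        useg , kseg = infix-of-chain α seg β₂ (subst Unique c≡ uc) (subst (Consec G) c≡ kc)
    in ⊥-elim (no-trans u v (Guv , m ∷ β₁ , s≤s z≤n , s≤s (s≤s z≤n) , useg , kseg))
  edge-in-chain⇒Adjacent no-circuit no-trans uc kc {u} {v} u∈c v∈c Guv
    | inj₂ v∈αβ | inj₁ v∈α with α₁ , α₂ , refl ← ∈-∃++ v∈α =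
    let seg = v ∷ α₂ ++ u ∷ []
        c≡  = trans (++-assoc α₁ (v ∷ α₂) (u ∷ β)) (cong (λ l → α₁ ++ v ∷ l) (sym (++-assoc α₂ (u ∷ []) β)))
        useg , kseg = infix-of-chain α₁ seg β (subst Unique c≡ uc) (subst (Consec G) c≡ kc)
    in ⊥-elim (no-circuit (v , α₂ ++ u ∷ [] , u , useg , kseg , Last-∷ʳ v u α₂ , Guv))

module ChainRegion {n : ℕ} (G : Graph n) {c : List (Fin n)} (uc : Unique c) (kc : Consec G c) where
  open Chains G

  C : VSet n
  C = listSet c

  restrict-to-chain : {T : VSet n} → (∀ {v} → C v ≡ true → T v ≡ true) →
    ∀ {p} → IsLinExt G T p → filterᵇ C p ≡ c
  restrict-to-chain C⊆T {p} le = adjacent-order⇒≡ uc (Unique-filterᵇ C unique)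
    (mk⇔ (λ v∈ → ∈ˡ⇒∈ c (proj₂ (∈-filterᵇ⁻ C p v∈))) (λ v∈c → ∈-filterᵇ⁺ C (⊇S (C⊆T (∈⇒∈ˡ v∈c))) (∈⇒∈ˡ v∈c)))
    λ s → let Cu = ∈⇒∈ˡ (Adjacent-∈₁ s) ; Cv = ∈⇒∈ˡ (Adjacent-∈₂ s) in
      trans (beforeᵇ-filterᵇ C p Cu Cv) (respects (C⊆T Cu) (C⊆T Cv) (Consec-Adjacent⇒Edge kc s))
    where open IsLinExt le

  chainPairs : List (Fin n) → List (Fin n × Fin n)
  chainPairs []          = []
  chainPairs (a ∷ [])    = []
  chainPairs (a ∷ b ∷ w) = (a , b) ∷ chainPairs (b ∷ w)

  ∈chainPairs⇒Adjacent : (l : List (Fin n)) {u v : Fin n} → (u , v) ∈ chainPairs l → Adjacent l u v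
  ∈chainPairs⇒Adjacent (a ∷ b ∷ w) (here refl) = adj-here
  ∈chainPairs⇒Adjacent (a ∷ b ∷ w) (there m)   = adj-there (∈chainPairs⇒Adjacent (b ∷ w) m)

  Adjacent⇒∈chainPairs : {l : List (Fin n)} {u v : Fin n} → Adjacent l u v → (u , v) ∈ chainPairs l
  Adjacent⇒∈chainPairs adj-here                    = here refl
  Adjacent⇒∈chainPairs {a ∷ b ∷ w} (adj-there s) = there (Adjacent⇒∈chainPairs s)

  Unique-chainPairs : {l : List (Fin n)} → Unique l → Unique (chainPairs l)
  Unique-chainPairs {[]}        _ = []
  Unique-chainPairs {a ∷ []}    _ = []
  Unique-chainPairs {a ∷ b ∷ w} u@(_ ∷ u′) =
    Unique-∷ (Unique[x∷xs]⇒x∉xs u ∘ Adjacent-∈₁ ∘ ∈chainPairs⇒Adjacent (b ∷ w)) (Unique-chainPairs u′)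

  module _ (no-circuit : ¬ HasCircuit G) (no-trans : ∀ u v → ¬ TransitivityEdge G u v) where

    edge-in-C⇒Adjacent : ∀ {u v} → C u ≡ true → C v ≡ true → G u v ≡ true → Adjacent c u v
    edge-in-C⇒Adjacent Cu Cv = edge-in-chain⇒Adjacent no-circuit no-trans uc kc (∈ˡ⇒∈ c Cu) (∈ˡ⇒∈ c Cv)

    edgesIn-chain : edgesIn G C ↭ chainPairs c
    edgesIn-chain = Unique-⇔⇒↭ (Unique-edgesIn G C) (Unique-chainPairs uc) λ { {u , v} → mk⇔
      (λ e∈ → let Cu , Cv , Guv = ∈edgesIn⁻ G C e∈ in Adjacent⇒∈chainPairs (edge-in-C⇒Adjacent Cu Cv Guv))
      (λ e∈ → let s = ∈chainPairs⇒Adjacent c e∈ in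
         ∈edgesIn⁺ G C (∈⇒∈ˡ (Adjacent-∈₁ s)) (∈⇒∈ˡ (Adjacent-∈₂ s)) (Consec-Adjacent⇒Edge kc s)) }

    linExts-chain : linExts G C ↭ c ∷ []
    linExts-chain = Unique-⇔⇒↭ (Unique-linExts G C) ([] ∷ []) (mk⇔
      (λ w∈ → let open IsLinExt (∈linExts⇒IsLinExt G C w∈) in
        here (adjacent-order⇒≡ uc unique (mk⇔ (∈ˡ⇒∈ c ∘ ⊆S) (⊇S ∘ ∈⇒∈ˡ))
               λ s → respects (∈⇒∈ˡ (Adjacent-∈₁ s)) (∈⇒∈ˡ (Adjacent-∈₂ s)) (Consec-Adjacent⇒Edge kc s)))
      λ { (here refl) → IsLinExt⇒∈linExts G C record
            { unique = uc ; ⊆S = ∈⇒∈ˡ ; ⊇S = ∈ˡ⇒∈ c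
            ; respects = λ Cu Cv Guv → Adjacent-beforeᵇ uc (edge-in-C⇒Adjacent Cu Cv Guv) } })

    module _ (x : Fin n → ℚ) where
      open Differences x

      prod-chainPairs : (l : List (Fin n)) → prodℚ (map edgeDiff (chainPairs l)) ≡ Δ l
      prod-chainPairs []          = refl
      prod-chainPairs (a ∷ [])    = refl
      prod-chainPairs (a ∷ b ∷ w) = cong (d a b *_) (prod-chainPairs (b ∷ w))

      prod-edgesIn-chain : prodℚ (map edgeDiff (edgesIn G C)) ≡ Δ c
      prod-edgesIn-chain = trans (prodℚ-map-↭ edgeDiff edgesIn-chain) (prod-chainPairs c)

      N-chain : Injective _≡_ _≡_ x → N G C x ≡ 1ℚ
      N-chain x-injective = begin
        sumℚ (map ψ (linExts G C)) * prodℚ (map edgeDiff (edgesIn G C))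
          ≡⟨ cong₂ _*_ (sumℚ-map-↭ ψ linExts-chain) prod-edgesIn-chain ⟩
        (ψ c + 0ℚ) * Δ c  ≡⟨ cong (_* Δ c) (+-identityʳ (ψ c)) ⟩
        ψ c * Δ c         ≡⟨ Injectivity.ψ*Δ≡1 x-injective uc ⟩
        1ℚ                ∎
        where open ≡-Reasoning

module Regions {n : ℕ} (G : Graph n) {A B C : VSet n}
  (A∩B≡∅ : ∀ {v} → A v ≡ true → B v ≡ false) (A∩C≡∅ : ∀ {v} → A v ≡ true → C v ≡ false)
  (B∩C≡∅ : ∀ {v} → B v ≡ true → C v ≡ false)
  (no-edge-A→B : ∀ {u v} → A u ≡ true → B v ≡ true → G u v ≡ false)
  (no-edge-B→A : ∀ {u v} → B u ≡ true → A v ≡ true → G u v ≡ false) where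

  P Q S : VSet n
  P = A ∪ C
  Q = B ∪ C
  S = (A ∪ B) ∪ C

  C⊆P : ∀ {v} → C v ≡ true → P v ≡ true
  C⊆P {v} = ∨≡true⁺ʳ {A v}

  C⊆Q : ∀ {v} → C v ≡ true → Q v ≡ true
  C⊆Q {v} = ∨≡true⁺ʳ {B v}

  P⊆S : ∀ {v} → P v ≡ true → S v ≡ true
  P⊆S {v} Pv = [ (λ Av → ∨≡true⁺ˡ (∨≡true⁺ˡ {A v} Av)) , ∨≡true⁺ʳ {A v ∨ B v} ]′ (∨≡true⁻ {A v} Pv)

  Q⊆S : ∀ {v} → Q v ≡ true → S v ≡ true
  Q⊆S {v} Qv = [ (λ Bv → ∨≡true⁺ˡ (∨≡true⁺ʳ {A v} Bv)) , ∨≡true⁺ʳ {A v ∨ B v} ]′ (∨≡true⁻ {B v} Qv)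

  S⇒A⊎B⊎C : ∀ {v} → S v ≡ true → A v ≡ true ⊎ B v ≡ true ⊎ C v ≡ true
  S⇒A⊎B⊎C {v} Sv = [ ⊎-map₂ inj₁ ∘ ∨≡true⁻ {A v} , inj₂ ∘ inj₂ ]′ (∨≡true⁻ {A v ∨ B v} Sv)

  S⊆P∪Q : ∀ {v} → S v ≡ true → P v ∨ Q v ≡ true
  S⊆P∪Q {v} Sv =
    [ (λ Av → ∨≡true⁺ˡ (∨≡true⁺ˡ {A v} Av))
    , [ (λ Bv → ∨≡true⁺ʳ {P v} (∨≡true⁺ˡ {B v} Bv)) , (λ Cv → ∨≡true⁺ˡ (C⊆P Cv)) ]′ ]′ (S⇒A⊎B⊎C Sv)

  P∩Q⊆C : ∀ {v} → P v ≡ true → Q v ≡ true → C v ≡ true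
  P∩Q⊆C {v} Pv Qv with ∨≡true⁻ {A v} Pv | ∨≡true⁻ {B v} Qv
  ... | inj₂ Cv | _       = Cv
  ... | inj₁ _  | inj₂ Cv = Cv
  ... | inj₁ Av | inj₁ Bv = ⊥-elim (not-¬ Bv (A∩B≡∅ Av))

  Q≡C-on-P : ∀ {v} → P v ≡ true → Q v ≡ C v
  Q≡C-on-P {v} Pv with ∨≡true⁻ {A v} Pv
  ... | inj₁ Av = trans (cong₂ _∨_ (A∩B≡∅ Av) (A∩C≡∅ Av)) (sym (A∩C≡∅ Av))
  ... | inj₂ Cv = trans (C⊆Q Cv) (sym Cv)

  P≡C-on-Q : ∀ {v} → Q v ≡ true → P v ≡ C v
  P≡C-on-Q {v} Qv with ∨≡true⁻ {B v} Qv | A v in Av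
  ... | inj₁ Bv | true  = ⊥-elim (not-¬ Bv (A∩B≡∅ Av))
  ... | inj₁ _  | false = refl
  ... | inj₂ Cv | a     = trans (∨≡true⁺ʳ {a} Cv) (sym Cv)

  edge-split : ∀ {u v} → S u ≡ true → S v ≡ true → G u v ≡ true →
    (P u ≡ true × P v ≡ true) ⊎ (Q u ≡ true × Q v ≡ true)
  edge-split Su Sv Guv with S⇒A⊎B⊎C Su | S⇒A⊎B⊎C Sv
  ... | inj₁ Au        | inj₁ Av        = inj₁ (∨≡true⁺ˡ Au , ∨≡true⁺ˡ Av)
  ... | inj₁ Au        | inj₂ (inj₁ Bv) = ⊥-elim (not-¬ Guv (no-edge-A→B Au Bv))
  ... | inj₁ Au        | inj₂ (inj₂ Cv) = inj₁ (∨≡true⁺ˡ Au , C⊆P Cv)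
  ... | inj₂ (inj₁ Bu) | inj₁ Av        = ⊥-elim (not-¬ Guv (no-edge-B→A Bu Av))
  ... | inj₂ (inj₁ Bu) | inj₂ (inj₁ Bv) = inj₂ (∨≡true⁺ˡ Bu , ∨≡true⁺ˡ Bv)
  ... | inj₂ (inj₁ Bu) | inj₂ (inj₂ Cv) = inj₂ (∨≡true⁺ˡ Bu , C⊆Q Cv)
  ... | inj₂ (inj₂ Cu) | inj₁ Av        = inj₁ (C⊆P Cu , ∨≡true⁺ˡ Av)
  ... | inj₂ (inj₂ Cu) | inj₂ (inj₁ Bv) = inj₂ (C⊆Q Cu , ∨≡true⁺ˡ Bv)
  ... | inj₂ (inj₂ Cu) | inj₂ (inj₂ Cv) = inj₁ (C⊆P Cu , C⊆P Cv)

  edgeᵇ-∧ : ∀ e → edgeᵇ G P e ∧ edgeᵇ G Q e ≡ edgeᵇ G C e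
  edgeᵇ-∧ (u , v) = ≡true-ext
    (λ e → let PQ , QQ = ∧≡true⁻ e ; Pu , Pv , Guv = edgeᵇ≡true⁻ G P PQ ; Qu , Qv , _ = edgeᵇ≡true⁻ G Q QQ in
      edgeᵇ≡true⁺ G C (P∩Q⊆C Pu Qu) (P∩Q⊆C Pv Qv) Guv)
    (λ e → let Cu , Cv , Guv = edgeᵇ≡true⁻ G C e in
      ∧≡true⁺ (edgeᵇ≡true⁺ G P (C⊆P Cu) (C⊆P Cv) Guv) (edgeᵇ≡true⁺ G Q (C⊆Q Cu) (C⊆Q Cv) Guv))

  edgeᵇ-∨ : ∀ e → edgeᵇ G P e ∨ edgeᵇ G Q e ≡ edgeᵇ G S e
  edgeᵇ-∨ (u , v) = ≡true-ext
    (λ e → [ (λ eP → let Pu , Pv , Guv = edgeᵇ≡true⁻ G P eP in edgeᵇ≡true⁺ G S (P⊆S Pu) (P⊆S Pv) Guv)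
           , (λ eQ → let Qu , Qv , Guv = edgeᵇ≡true⁻ G Q eQ in edgeᵇ≡true⁺ G S (Q⊆S Qu) (Q⊆S Qv) Guv)
           ]′ (∨≡true⁻ e))
    (λ e → let Su , Sv , Guv = edgeᵇ≡true⁻ G S e in
      [ (λ (Pu , Pv) → ∨≡true⁺ˡ (edgeᵇ≡true⁺ G P Pu Pv Guv))
      , (λ (Qu , Qv) → ∨≡true⁺ʳ {edgeᵇ G P (u , v)} (edgeᵇ≡true⁺ G Q Qu Qv Guv)) ]′ (edge-split Su Sv Guv))

module Gluing {n : ℕ} (G : Graph n) (x : Fin n → ℚ) (x-injective : Injective _≡_ _≡_ x)
  (no-circuit : ¬ HasCircuit G) (no-trans : ∀ u v → ¬ TransitivityEdge G u v)
  {c : List (Fin n)} (uc : Unique c) (kc : Consec G c) (c≢[] : c ≢ [])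
  {A B : VSet n}
  (A∩B≡∅ : ∀ {v} → A v ≡ true → B v ≡ false) (A∩C≡∅ : ∀ {v} → A v ≡ true → listSet c v ≡ false)
  (B∩C≡∅ : ∀ {v} → B v ≡ true → listSet c v ≡ false)
  (no-edge-A→B : ∀ {u v} → A u ≡ true → B v ≡ true → G u v ≡ false)
  (no-edge-B→A : ∀ {u v} → B u ≡ true → A v ≡ true → G u v ≡ false) where

  open ChainRegion G uc kc
  open Regions G A∩B≡∅ A∩C≡∅ B∩C≡∅ no-edge-A→B no-edge-B→A
  open Differences x
  open Injectivity x-injective
  open Merge C
  open MergeSum x x-injective C
  open ≡-Reasoning

  Compatible-linExts : ∀ {p q} → IsLinExt G P p → IsLinExt G Q q → Compatible {P = P} {Q} p q
  Compatible-linExts leP leQ = record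
    { uniqueˡ = IsLinExt.unique leP ; uniqueʳ = IsLinExt.unique leQ
    ; ⊆P = IsLinExt.⊆S leP ; ⊆Q = IsLinExt.⊆S leQ
    ; Q≡C-on-p = Q≡C-on-P ∘ IsLinExt.⊆S leP ; P≡C-on-q = P≡C-on-Q ∘ IsLinExt.⊆S leQ
    ; sameChain = trans (restrict-to-chain C⊆P leP) (sym (restrict-to-chain C⊆Q leQ)) }

  shuffles : List (List (Fin n))
  shuffles = concatMap (λ p → concatMap (merge p) (linExts G Q)) (linExts G P)

  ∈shuffles⁻ : ∀ {w} → w ∈ shuffles →
    ∃ λ p → ∃ λ q → p ∈ linExts G P × q ∈ linExts G Q × w ∈ merge p q
  ∈shuffles⁻ w∈ with p , p∈ , w∈′ ← ∈-concatMap⁻′ (λ p → concatMap (merge p) (linExts G Q)) (linExts G P) w∈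
                  with q , q∈ , w∈″ ← ∈-concatMap⁻′ (merge p) (linExts G Q) w∈′ = p , q , p∈ , q∈ , w∈″

  IsMergeOf-linExts : ∀ {p q w} → p ∈ linExts G P → q ∈ linExts G Q → w ∈ merge p q → IsMergeOf {P = P} {Q} p q w
  IsMergeOf-linExts p∈ q∈ =
    merge-sound _ _ (Compatible-linExts (∈linExts⇒IsLinExt G P p∈) (∈linExts⇒IsLinExt G Q q∈))

  linExts⊆shuffles : ∀ {w} → w ∈ linExts G S → w ∈ shuffles
  linExts⊆shuffles {w} w∈ =
    ∈-concatMap⁺′ (λ p → concatMap (merge p) (linExts G Q)) (IsLinExt⇒∈linExts G P (IsLinExt-restrict G P⊆S le))
      (∈-concatMap⁺′ (merge (filterᵇ P w)) (IsLinExt⇒∈linExts G Q (IsLinExt-restrict G Q⊆S le))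
        (merge-complete P Q C⊆P C⊆Q P∩Q⊆C w (S⊆P∪Q ∘ IsLinExt.⊆S le)))
    where le = ∈linExts⇒IsLinExt G S w∈

  shuffles⊆linExts : ∀ {w} → w ∈ shuffles → w ∈ linExts G S
  shuffles⊆linExts {w} w∈ with p , q , p∈ , q∈ , w∈pq ← ∈shuffles⁻ w∈ =
    IsLinExt⇒∈linExts G S (IsLinExt-glue G S⊆P∪Q edge-split (IsMergeOf.unique m)
      (λ v∈w → [ P⊆S ∘ IsLinExt.⊆S leP , Q⊆S ∘ IsLinExt.⊆S leQ ]′ (IsMergeOf.⊆p∪q m v∈w))
      (subst (IsLinExt G P) (sym (IsMergeOf.restrictˡ m)) leP)
      (subst (IsLinExt G Q) (sym (IsMergeOf.restrictʳ m)) leQ))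
    where
    leP = ∈linExts⇒IsLinExt G P p∈
    leQ = ∈linExts⇒IsLinExt G Q q∈
    m   = IsMergeOf-linExts p∈ q∈ w∈pq

  Unique-shuffles : Unique shuffles
  Unique-shuffles =
    Unique-concatMap (λ p → concatMap (merge p) (linExts G Q)) (Unique-linExts G P)
      (λ {p} p∈ → Unique-concatMap (merge p) (Unique-linExts G Q)
        (λ {q} q∈ → Unique-merge p q (Compatible-linExts (∈linExts⇒IsLinExt G P p∈) (∈linExts⇒IsLinExt G Q q∈)))
        (λ q∈ q′∈ w∈ w∈′ → trans (sym (IsMergeOf.restrictʳ (IsMergeOf-linExts p∈ q∈ w∈)))
                                  (IsMergeOf.restrictʳ (IsMergeOf-linExts p∈ q′∈ w∈′))))
      (λ p∈ p′∈ w∈ w∈′ → trans (sym (restrictˡ-of p∈ w∈)) (restrictˡ-of p′∈ w∈′))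
    where
    restrictˡ-of : ∀ {p w} → p ∈ linExts G P → w ∈ concatMap (merge p) (linExts G Q) → filterᵇ P w ≡ p
    restrictˡ-of {p} p∈ w∈ with q , q∈ , w∈′ ← ∈-concatMap⁻′ (merge p) (linExts G Q) w∈ =
      IsMergeOf.restrictˡ (IsMergeOf-linExts p∈ q∈ w∈′)

  linExts-glue : linExts G S ↭ shuffles
  linExts-glue = Unique-⇔⇒↭ (Unique-linExts G S) Unique-shuffles (mk⇔ linExts⊆shuffles shuffles⊆linExts)

  Σψ-merge-linExts : ∀ {p q} → p ∈ linExts G P → q ∈ linExts G Q → sumℚ (map ψ (merge p q)) ≡ ψ p * ψ q * Δ c
  Σψ-merge-linExts {p} {q} p∈ q∈ =
    trans (Σψ-merge p q (Compatible-linExts leP (∈linExts⇒IsLinExt G Q q∈)) (c≢[] ∘ trans (sym chain≡)))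
          (cong (Φ₀ p q) chain≡)
    where
    leP = ∈linExts⇒IsLinExt G P p∈
    chain≡ = restrict-to-chain C⊆P leP

  Ψ-glue : Ψ G S x ≡ Ψ G P x * Ψ G Q x * Δ c
  Ψ-glue = begin
    sumℚ (map ψ (linExts G S))
      ≡⟨ sumℚ-map-↭ ψ linExts-glue ⟩
    sumℚ (map ψ shuffles)
      ≡⟨ sumℚ-map-concatMap ψ (λ p → concatMap (merge p) (linExts G Q)) (linExts G P) ⟩
    sumℚ (map (λ p → sumℚ (map ψ (concatMap (merge p) (linExts G Q)))) (linExts G P))
      ≡⟨ sumℚ-map-cong (linExts G P) (λ {p} p∈ → trans (sumℚ-map-concatMap ψ (merge p) (linExts G Q))
           (sumℚ-map-cong (linExts G Q) (Σψ-merge-linExts p∈))) ⟩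
    sumℚ (map (λ p → sumℚ (map (λ q → ψ p * ψ q * Δ c) (linExts G Q))) (linExts G P))
      ≡⟨ sumℚ-map-product ψ ψ (Δ c) (linExts G P) (linExts G Q) ⟩
    Ψ G P x * Ψ G Q x * Δ c ∎

  prod-edgesIn-glue :
    prodℚ (map edgeDiff (edgesIn G S)) * Δ c ≡ prodℚ (map edgeDiff (edgesIn G P)) * prodℚ (map edgeDiff (edgesIn G Q))
  prod-edgesIn-glue = begin
    Π (edgeᵇ G S) * Δ c
      ≡⟨ cong (Π (edgeᵇ G S) *_) (sym (prod-edgesIn-chain no-circuit no-trans x)) ⟩
    Π (edgeᵇ G S) * Π (edgeᵇ G C)
      ≡⟨ *-comm (Π (edgeᵇ G S)) (Π (edgeᵇ G C)) ⟩
    Π (edgeᵇ G C) * Π (edgeᵇ G S)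
      ≡⟨ sym (cong₂ _*_ (cong (prodℚ ∘ map edgeDiff) (filterᵇ-cong edgeᵇ-∧ vertexPairs))
                        (cong (prodℚ ∘ map edgeDiff) (filterᵇ-cong edgeᵇ-∨ vertexPairs))) ⟩
    Π (λ e → edgeᵇ G P e ∧ edgeᵇ G Q e) * Π (λ e → edgeᵇ G P e ∨ edgeᵇ G Q e)
      ≡⟨ sym (prodℚ-filterᵇ-∧-∨ edgeDiff (edgeᵇ G P) (edgeᵇ G Q) vertexPairs) ⟩
    Π (edgeᵇ G P) * Π (edgeᵇ G Q) ∎
    where
    Π : (Fin n × Fin n → Bool) → ℚ
    Π h = prodℚ-filterᵇ edgeDiff h vertexPairs

  N-glue : N G S x ≡ N G P x * N G Q x
  N-glue = begin
    Ψ G S x * ES                  ≡⟨ cong (_* ES) Ψ-glue ⟩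
    Ψ G P x * Ψ G Q x * Δ c * ES  ≡⟨ solve 4 (λ a b e s → a :* b :* e :* s := (a :* b) :* (s :* e)) refl (Ψ G P x) (Ψ G Q x) (Δ c) ES ⟩
    (Ψ G P x * Ψ G Q x) * (ES * Δ c) ≡⟨ cong ((Ψ G P x * Ψ G Q x) *_) prod-edgesIn-glue ⟩
    (Ψ G P x * Ψ G Q x) * (EP * EQ)  ≡⟨ solve 4 (λ a b p q → (a :* b) :* (p :* q) := (a :* p) :* (b :* q)) refl (Ψ G P x) (Ψ G Q x) EP EQ ⟩
    (Ψ G P x * EP) * (Ψ G Q x * EQ)  ∎
    where
    ES = prodℚ (map edgeDiff (edgesIn G S))
    EP = prodℚ (map edgeDiff (edgesIn G P))
    EQ = prodℚ (map edgeDiff (edgesIn G Q))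

module _ {n : ℕ} (G : Graph n) (x : Fin n → ℚ) where
  open Differences x

  all-cong : {S S′ : VSet n} → (∀ v → S v ≡ S′ v) → (w : List (Fin n)) → all S w ≡ all S′ w
  all-cong S≗S′ []      = refl
  all-cong S≗S′ (a ∷ w) = cong₂ _∧_ (S≗S′ a) (all-cong S≗S′ w)

  edgesIn-cong : {S S′ : VSet n} → (∀ v → S v ≡ S′ v) → edgesIn G S ≡ edgesIn G S′
  edgesIn-cong S≗S′ = filterᵇ-cong (λ (u , v) → cong₂ _∧_ (S≗S′ u) (cong (_∧ G u v) (S≗S′ v))) vertexPairs

  linExts-cong : {S S′ : VSet n} → (∀ v → S v ≡ S′ v) → linExts G S ≡ linExts G S′
  linExts-cong {S} {S′} S≗S′ =
    trans (filterᵇ-cong (λ w → cong₂ _∧_ (all-cong S≗S′ w)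
                                  (cong (λ E → nodupᵇ w ∧ all (λ e → beforeᵇ (proj₁ e) (proj₂ e) w) E) (edgesIn-cong S≗S′)))
                        (words (length (elems S))))
          (cong (λ m → filterᵇ (isLinExtᵇ G S′) (words m)) (cong length (filterᵇ-cong S≗S′ (allFin n))))

  N-cong : {S S′ : VSet n} → (∀ v → S v ≡ S′ v) → N G S x ≡ N G S′ x
  N-cong S≗S′ = cong₂ (λ L E → sumℚ (map ψ L) * prodℚ (map edgeDiff E)) (linExts-cong S≗S′) (edgesIn-cong S≗S′)

⋃ : ∀ {n} (k : ℕ) → (Fin k → VSet n) → VSet n
⋃ zero    comp v = false
⋃ (suc k) comp v = comp zero v ∨ ⋃ k (comp ∘ suc) v

∈⋃⁻ : ∀ {n} (k : ℕ) (comp : Fin k → VSet n) {v} → ⋃ k comp v ≡ true → ∃ λ j → comp j v ≡ true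
∈⋃⁻ (suc k) comp {v} e with ∨≡true⁻ {comp zero v} e
... | inj₁ c₀ = zero , c₀
... | inj₂ e′ = let j , cj = ∈⋃⁻ k (comp ∘ suc) e′ in suc j , cj

∈⋃⁺ : ∀ {n} (k : ℕ) (comp : Fin k → VSet n) {v} (j : Fin k) → comp j v ≡ true → ⋃ k comp v ≡ true
∈⋃⁺ (suc k) comp zero    cj = ∨≡true⁺ˡ cj
∈⋃⁺ (suc k) comp {v} (suc j) cj = ∨≡true⁺ʳ {comp zero v} (∈⋃⁺ k (comp ∘ suc) j cj)

prodℚ-allFin-suc : (k : ℕ) (f : Fin (suc k) → ℚ) →
  prodℚ (map f (allFin (suc k))) ≡ f zero * prodℚ (map (f ∘ suc) (allFin k))
prodℚ-allFin-suc k f =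
  cong (λ L → f zero * prodℚ L) (trans (map-tabulate suc f) (sym (map-tabulate (λ j → j) (f ∘ suc))))

module Components {n : ℕ} (G : Graph n) (x : Fin n → ℚ) (x-injective : Injective _≡_ _≡_ x)
  (no-circuit : ¬ HasCircuit G) (no-trans : ∀ u v → ¬ TransitivityEdge G u v)
  {c : List (Fin n)} (uc : Unique c) (kc : Consec G c) (c≢[] : c ≢ []) where
  open ChainRegion G uc kc
  open ≡-Reasoning

  N-⋃ : (k : ℕ) (comp : Fin k → VSet n) →
    (∀ {j v} → comp j v ≡ true → C v ≡ false) →
    (∀ {j j′ v} → comp j v ≡ true → comp j′ v ≡ true → j ≡ j′) →
    (∀ {j j′ u v} → comp j u ≡ true → comp j′ v ≡ true → G u v ≡ true → j ≡ j′) →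
    N G (⋃ k comp ∪ C) x ≡ prodℚ (map (λ j → N G (comp j ∪ C) x) (allFin k))
  N-⋃ zero    comp _ _ _ = N-chain no-circuit no-trans x x-injective
  N-⋃ (suc k) comp comp∩C≡∅ disjoint no-edge = begin
    N G ((A ∪ B) ∪ C) x                                        ≡⟨ N-glue ⟩
    N G (A ∪ C) x * N G (B ∪ C) x
      ≡⟨ cong (N G (A ∪ C) x *_) (N-⋃ k (comp ∘ suc) comp∩C≡∅
           (suc-injective ∘₂ disjoint) (λ cu cv Guv → suc-injective (no-edge cu cv Guv))) ⟩
    N G (A ∪ C) x * prodℚ (map (λ j → N G (comp (suc j) ∪ C) x) (allFin k))
      ≡⟨ sym (prodℚ-allFin-suc k (λ j → N G (comp j ∪ C) x)) ⟩
    prodℚ (map (λ j → N G (comp j ∪ C) x) (allFin (suc k))) ∎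
    where
    A B : VSet n
    A = comp zero
    B = ⋃ k (comp ∘ suc)
    zero≢suc : ∀ {j : Fin k} → zero ≢ suc j
    zero≢suc ()
    A∩B≡∅ : ∀ {v} → A v ≡ true → B v ≡ false
    A∩B≡∅ Av = ¬-not λ Bv → zero≢suc (disjoint Av (proj₂ (∈⋃⁻ k (comp ∘ suc) Bv)))
    B∩C≡∅ : ∀ {v} → B v ≡ true → C v ≡ false
    B∩C≡∅ Bv = comp∩C≡∅ (proj₂ (∈⋃⁻ k (comp ∘ suc) Bv))
    no-edge-A→B : ∀ {u v} → A u ≡ true → B v ≡ true → G u v ≡ false
    no-edge-A→B Au Bv = ¬-not λ Guv → zero≢suc (no-edge Au (proj₂ (∈⋃⁻ k (comp ∘ suc) Bv)) Guv)
    no-edge-B→A : ∀ {u v} → B u ≡ true → A v ≡ true → G u v ≡ false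
    no-edge-B→A Bu Av = ¬-not λ Guv → zero≢suc (sym (no-edge (proj₂ (∈⋃⁻ k (comp ∘ suc) Bu)) Av Guv))
    open Gluing G x x-injective no-circuit no-trans uc kc c≢[] A∩B≡∅ comp∩C≡∅ B∩C≡∅ no-edge-A→B no-edge-B→A

mainTheorem8 : (n : ℕ) (G : Graph n) → Connected G → ¬ HasCircuit G →
    (∀ u v → ¬ TransitivityEdge G u v) →
    (c : List (Fin n)) → IsChain G c →
    (k : ℕ) (comp : Fin k → VSet n) →
    (∀ j → IsComponent G (complement (listSet c)) (comp j)) →
    (∀ v → complement (listSet c) v ≡ true →
      Σ (Fin k) λ j → comp j v ≡ true × (∀ j′ → comp j′ v ≡ true → j′ ≡ j)) →
    (x : Fin n → ℚ) → Injective _≡_ _≡_ x →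
    N G allV x ≡ prodℚ (map (λ j → N G (comp j ∪ listSet c) x) (allFin k))
mainTheorem8 n G _ no-circuit no-trans c (2≤|c| , uc , kc) k comp isComp cover x x-injective =
  trans (N-cong G x covered) (N-⋃ k comp comp∩C≡∅ disjoint no-edge)
  where
  c≢[] : c ≢ []
  c≢[] c≡[] with () ← subst (λ l → 2 ≤ length l) c≡[] 2≤|c|

  open Components G x x-injective no-circuit no-trans uc kc c≢[]

  comp∩C≡∅ : ∀ {j v} → comp j v ≡ true → listSet c v ≡ false
  comp∩C≡∅ {j} {v} cj = not-injective (proj₁ (isComp j) v cj)

  disjoint : ∀ {j j′ v} → comp j v ≡ true → comp j′ v ≡ true → j ≡ j′
  disjoint {j} {j′} {v} cj cj′ with _ , _ , unique ← cover v (proj₁ (isComp j) v cj) =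
    trans (unique j cj) (sym (unique j′ cj′))

  no-edge : ∀ {j j′ u v} → comp j u ≡ true → comp j′ v ≡ true → G u v ≡ true → j ≡ j′
  no-edge {j} {j′} {u} {v} cu cv Guv =
    disjoint (proj₂ (proj₂ (proj₂ (isComp j))) u v cu (proj₁ (isComp j′) v cv) (inj₁ Guv)) cv

  covered : ∀ v → allV v ≡ (⋃ k comp ∪ listSet c) v
  covered v with listSet c v in Cv
  ... | true  = sym (∨-zeroʳ (⋃ k comp v))
  ... | false with j , cj , _ ← cover v (cong not Cv) = sym (∨≡true⁺ˡ (∈⋃⁺ k comp j cj))
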